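{- The linear map $\varphi_2:\mathrm{HSym}\to\mathrm{SSym}$ is a Hopf algebra homomorphism, where $\mathrm{HSym}$ carries the weight $-1$ Hopf algebra structure.
   Context: $\mathfrak{B}_n$ is the set of permutations $\pi$ of $\{ -n,\dots,n\}$ with $\pi(-i)=-\pi(i)$, written as words $\pi_1\cdots\pi_n$, $\mathfrak{B}_0=\{\imath\}$; $\mathfrak{S}_n\subseteq\mathfrak{B}_n$ those with all entries positive. $\mathrm{HSym}=\bigoplus_n\mathbf{k}\mathfrak{B}_n$, $\mathrm{SSym}=\bigoplus_n\mathbf{k}\mathfrak{S}_n$. $\mathrm{st}$ of a word $a_1\cdots a_n$ over $\mathbb{Z}\setminus\{0\}$ is the unique $b_1\cdots b_n\in\mathfrak{B}_n$ with $\mathrm{sign}(b_i)=\mathrm{sign}(a_i)$ and $|b_i|<|b_j|$ whenever $|a_i|<|a_j|$ or ($|a_i|=|a_j|$, $i<j$), extended linearly. On words over $\mathbb{Z}\setminus\{0\}$, $\star_{ -1}$ is the bilinear product with the empty word as identity and $au\star_{ -1}bv=a(u\star_{ -1}bv)+b(au\star_{ -1}v)-(a\bullet b)(u\star_{ -1}v)$, where $a\bullet b=a$ if $a,b<0$ and $0$ otherwise. $\mathrm{HSym}$ has product $\sigma\overline{\star}_{ -1}\tau=\mathrm{st}(\sigma\star_{ -1}\tau[m])$ for $\sigma\in\mathfrak{B}_m$ ($\tau[m]$ replaces positive letters $i$ by $i+m$ and negative letters $-i$ by $-(i+m)$), coproduct $\Delta(\sigma)=\sum_{p=0}^m\mathrm{st}(\sigma_1\cdots\sigma_p)\otimes\mathrm{st}(\sigma_{p+1}\cdots\sigma_m)$,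 counit $\epsilon(\sigma)=\delta_{\sigma,\imath}$. $\mathrm{SSym}$ (Malvenuto–Reutenauer) has the shifted shuffle product $\sigma\sqcup\!\sqcup\,\tau[m]$ and the same coproduct and counit. $\varphi_2$ is defined on $\pi\in\mathfrak{B}_n$ by $\varphi_2(\pi)=(-1)^j\mathrm{st}(\bar\pi)$ if there are $i\ge0$, $j\in\{0,1\}$ with $i+j<n$ such that $\pi_k<0$ for $k\le i$ and for $k>n-j$, and $\pi_k>0$ for $i<k\le n-j$ ($\bar\pi$ the subword of positive entries), and $\varphi_2(\pi)=\delta_{\pi,\imath}$ otherwise. -}

module Defs where

open import Level using (Level)
open import Data.Bool using (Bool; true; false; _∧_; _∨_; not; if_then_else_)
open import Data.Nat as ℕ using (ℕ; zero; suc; _≡ᵇ_; _<ᵇ_; _≤ᵇ_)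
open import Data.Integer as ℤ using (ℤ; +_; -[1+_]; ∣_∣)
open import Data.List using (List; []; _∷_; map; length; take; drop; upTo; applyUpTo;
  filterᵇ; concatMap; foldr; zip; lookup; null)
open import Data.List.Relation.Binary.Permutation.Propositional using (_↭_)
open import Data.List.Relation.Unary.All using (All)
open import Data.List.Properties using (≡-dec)
open import Data.Product using (_×_; _,_; proj₁; proj₂)
open import Data.Product.Properties as ×P using ()
open import Relation.Nullary using (yes; no)
open import Relation.Binary.PropositionalEquality using (_≡_)
open import Algebra.Bundles using (CommutativeRing)

-- Words over ℤ ∖ {0} (letters 0 never occur in basis elements)

Word : Set
Word = List ℤ

isNeg : ℤ → Bool
isNeg -[1+ _ ]     = true
isNeg (+ _)        = false

isPos : ℤ → Bool
isPos (+ suc _)    = true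
isPos _            = false

IsSignedPerm : Word → Set
IsSignedPerm w = map ∣_∣ w ↭ applyUpTo suc (length w)

-- an element of 𝔅_n given as a word (list of its values π₁⋯πₙ)

st : Word → Word
st w = map entry indexed
  where
  indexed : List (ℕ × ℤ)
  indexed = zip (upTo (length w)) w
  rank : ℕ → ℕ → ℕ
  rank i x = length (filterᵇ (λ p → (∣ proj₂ p ∣ <ᵇ x) ∨ ((∣ proj₂ p ∣ ≡ᵇ x) ∧ (proj₁ p ≤ᵇ i))) indexed)
  entry : ℕ × ℤ → ℤ
  entry (i , a) = if isNeg a then ℤ.- (+ rank i ∣ a ∣) else + rank i ∣ a ∣

shiftL : ℕ → ℤ → ℤ
shiftL m (+ zero)  = + zero
shiftL m (+ suc n) = + (suc n ℕ.+ m)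
shiftL m -[1+ n ]  = -[1+ (n ℕ.+ m) ]

shift : ℕ → Word → Word
shift m = map (shiftL m)

posPart : Word → Word
posPart = filterᵇ isPos

-- 1-indexed lookup, default 0 out of range
at : Word → ℕ → ℤ
at []      _             = + 0
at (a ∷ w) zero          = + 0
at (a ∷ w) (suc zero)    = a
at (a ∷ w) (suc (suc k)) = at w (suc k)

cond : ℕ → ℕ → Word → Bool
cond i j π = ((i ℕ.+ j) <ᵇ n) ∧ allPos (applyUpTo suc n)
  where
  n = length π
  ok : ℕ → Bool
  ok k = if (k ≤ᵇ i) ∨ ((n ℕ.∸ j) <ᵇ k) then isNeg (at π k) else isPos (at π k)
  allPos : List ℕ → Bool
  allPos = foldr (λ k b → ok k ∧ b) true

witnesses : Word → List (ℕ × ℕ)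
witnesses π = filterᵇ (λ p → cond (proj₁ p) (proj₂ p) π)
  (concatMap (λ i → (i , 0) ∷ (i , 1) ∷ []) (upTo (suc (length π))))

wordEq? = ≡-dec ℤ._≟_

module WithRing {c ℓ} (K : CommutativeRing c ℓ) where
  open CommutativeRing K renaming (Carrier to 𝐤)

  -- formal 𝐤-linear combinations of basis elements of type B
  FS : Set → Set c
  FS B = List (𝐤 × B)

  scale : {B : Set} → 𝐤 → FS B → FS B
  scale k = map (λ t → (k * proj₁ t , proj₂ t))

  linExt : {A B : Set} → (A → FS B) → FS A → FS B
  linExt f = concatMap (λ t → scale (proj₁ t) (f (proj₂ t)))

  bilinExt : {A B C : Set} → (A → B → FS C) → FS A → FS B → FS C
  bilinExt f x y = concatMap (λ s → concatMap (λ t → scale (proj₁ s * proj₁ t) (f (proj₂ s) (proj₂ t))) y) x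

  basis : {B : Set} → B → FS B
  basis b = (1# , b) ∷ []

  coeff : FS Word → Word → 𝐤
  coeff x w = foldr (λ t s → (if ⌊ wordEq? (proj₂ t) w ⌋ then proj₁ t else 0#) + s) 0# x
    where open import Relation.Nullary.Decidable using (⌊_⌋)

  _≈F_ : FS Word → FS Word → Set ℓ
  x ≈F y = ∀ w → coeff x w ≈ coeff y w

  coeffT : FS (Word × Word) → Word × Word → 𝐤
  coeffT x w = foldr (λ t s → (if ⌊ ×P.≡-dec wordEq? wordEq? (proj₂ t) w ⌋ then proj₁ t else 0#) + s) 0# x
    where open import Relation.Nullary.Decidable using (⌊_⌋)

  _≈T_ : FS (Word × Word) → FS (Word × Word) → Set ℓ
  x ≈T y = ∀ w → coeffT x w ≈ coeffT y w

  IsHSym : FS Word → Set c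
  IsHSym x = All (λ t → IsSignedPerm (proj₂ t)) x

  prefix : ℤ → FS Word → FS Word
  prefix a = map (λ t → (proj₁ t , a ∷ proj₂ t))

  -- the quasi-shuffle ⋆_{-1} on words, with a•b = a if a,b<0 and 0 otherwise
  star : Word → Word → FS Word
  star []      v       = basis v
  star (a ∷ u) []      = basis (a ∷ u)
  star (a ∷ u) (b ∷ v) =
    prefix a (star u (b ∷ v)) Data.List.++ prefix b (star (a ∷ u) v) Data.List.++
    (if isNeg a ∧ isNeg b then scale (- 1#) (prefix a (star u v)) else [])

  shuffle : Word → Word → FS Word
  shuffle []      v       = basis v
  shuffle (a ∷ u) []      = basis (a ∷ u)
  shuffle (a ∷ u) (b ∷ v) = prefix a (shuffle u (b ∷ v)) Data.List.++ prefix b (shuffle (a ∷ u) v)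

  _⋆H_ : FS Word → FS Word → FS Word
  _⋆H_ = bilinExt (λ σ τ → map (λ t → (proj₁ t , st (proj₂ t))) (star σ (shift (length σ) τ)))

  _⧢S_ : FS Word → FS Word → FS Word
  _⧢S_ = bilinExt (λ σ τ → shuffle σ (shift (length σ) τ))

  unit : FS Word
  unit = basis []

  -- coproduct (same formula in HSym and SSym)
  Δ : FS Word → FS (Word × Word)
  Δ = linExt (λ σ → map (λ p → (1# , (st (take p σ) , st (drop p σ)))) (upTo (suc (length σ))))

  -- counit (same formula in HSym and SSym)
  ε : FS Word → 𝐤
  ε x = foldr (λ t s → (proj₁ t * (if null (proj₂ t) then 1# else 0#)) + s) 0# x

  _≈K_ : 𝐤 → 𝐤 → Set ℓ
  _≈K_ = _≈_

  φ₂-basis : Word → FS Word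
  φ₂-basis π with witnesses π
  ... | (i , j) ∷ _ = ((if j ≡ᵇ 0 then 1# else - 1#) , st (posPart π)) ∷ []
  ... | []          = if null π then basis [] else []

  φ₂ : FS Word → FS Word
  φ₂ = linExt φ₂-basis

  φ₂⊗φ₂ : FS (Word × Word) → FS (Word × Word)
  φ₂⊗φ₂ = linExt (λ p → bilinExt (λ u v → basis (u , v)) (φ₂-basis (proj₁ p)) (φ₂-basis (proj₂ p)))

module Submission where

open import Defs
open import Data.Product using (_×_; _,_)
import Data.Product.Properties as ×P
open import Algebra.Bundles using (CommutativeRing)

-- A signed permutation π has φ₂(π) = c(π) · st(π̄), where the weight c(π) ∈ {1, −1, 0} is read off
-- the sign pattern of π by a five-state automaton: c = 1 on the empty word and on (−)*(+)⁺,
-- c = −1 on (−)*(+)⁺(−), c = 0 otherwise.  Standardisation commutes with taking prefixes, suffixes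
-- and positive parts of words with distinct absolute values, so compatibility with Δ reduces to
--   Σ_{uv = w} c(u) c(v) · ū ⊗ v̄ = c(w) · Σ_{xy = w̄} x ⊗ y,
-- and compatibility with the products to
--   Σ_t λ_t c(t) · t̄ = c(u) c(v) · ū ⧢ v̄   where u ⋆₋₁ v = Σ_t λ_t t.
-- Both are proved by induction on the words, letting the automaton start in an arbitrary state.

module Standardisation where

  open import Function using (_∘_; id; Equivalence)
  open import Data.Bool using (Bool; true; false; _∧_; _∨_; not; if_then_else_; T)
  open import Data.Bool.Properties using (T-≡)
  open import Data.Empty using (⊥-elim)
  open import Data.Nat using (ℕ; zero; suc; _+_; _≤_; _<_; z≤n; s≤s; _≤ᵇ_; _<ᵇ_; _≡ᵇ_)
  import Data.Nat.Properties as ℕP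
  open import Data.Integer as ℤ using (ℤ; +_; -[1+_]; ∣_∣)
  import Data.Integer.Properties as ℤP
  open import Data.List using (List; []; _∷_; _++_; map; length; filterᵇ; zip; upTo; take; drop)
  import Data.List.Properties as LP
  open import Data.List.Membership.Propositional using (_∈_)
  open import Data.List.Membership.Propositional.Properties
    using (∈-map⁺; ∈-map⁻; ∈-filter⁻; ∈-applyUpTo⁻; ∈-++⁺ˡ; ∈-++⁺ʳ)
  open import Data.List.Relation.Unary.Any using (here; there)
  open import Data.List.Relation.Unary.All as All using (All; []; _∷_)
  import Data.List.Relation.Unary.All.Properties as AllP
  open import Data.List.Relation.Unary.AllPairs using (AllPairs; []; _∷_)
  import Data.List.Relation.Unary.AllPairs.Properties as AllPairsP
  import Data.List.Relation.Unary.Unique.Propositional.Properties as UniqueP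
  open import Data.List.Relation.Binary.Permutation.Propositional using (_↭_; ↭⇒↭ₛ; ↭-sym)
  open import Data.List.Relation.Binary.Permutation.Propositional.Properties using (∈-resp-↭; ↭-length; filter-↭)
  open import Data.List.Relation.Binary.Permutation.Setoid.Properties using (Unique-resp-↭; AllPairs-resp-↭)
  open import Data.Product using (∃; _×_; _,_; proj₁; proj₂)
  open import Relation.Nullary using (¬_; yes; no)
  open import Relation.Binary.PropositionalEquality

  ≤ᵇ-true : ∀ {m n} → m ≤ n → (m ≤ᵇ n) ≡ true
  ≤ᵇ-true m≤n = Equivalence.to T-≡ (ℕP.≤⇒≤ᵇ m≤n)

  ≤ᵇ-sound : ∀ {m n} → (m ≤ᵇ n) ≡ true → m ≤ n
  ≤ᵇ-sound {m} {n} eq = ℕP.≤ᵇ⇒≤ m n (Equivalence.from T-≡ eq)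

  ≤ᵇ-false : ∀ {m n} → ¬ m ≤ n → (m ≤ᵇ n) ≡ false
  ≤ᵇ-false {m} {n} m≰n with m ≤ᵇ n in eq
  ... | true  = ⊥-elim (m≰n (≤ᵇ-sound eq))
  ... | false = refl

  ≤ᵇ-reflects : ∀ {m n m′ n′} → (m ≤ n → m′ ≤ n′) → (n < m → n′ < m′) → (m′ ≤ᵇ n′) ≡ (m ≤ᵇ n)
  ≤ᵇ-reflects {m} {n} mono strict with m ℕP.≤? n
  ... | yes m≤n = trans (≤ᵇ-true (mono m≤n)) (sym (≤ᵇ-true m≤n))
  ... | no  m≰n = trans (≤ᵇ-false (ℕP.<⇒≱ (strict (ℕP.≰⇒> m≰n)))) (sym (≤ᵇ-false m≰n))

  <ᵇ∨≡ᵇ-≤ᵇ : ∀ m x c → m ≢ x → ((m <ᵇ x) ∨ ((m ≡ᵇ x) ∧ c)) ≡ (m ≤ᵇ x)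
  <ᵇ∨≡ᵇ-≤ᵇ zero    zero    c m≢x = ⊥-elim (m≢x refl)
  <ᵇ∨≡ᵇ-≤ᵇ zero    (suc x) c m≢x = refl
  <ᵇ∨≡ᵇ-≤ᵇ (suc m) zero    c m≢x = refl
  <ᵇ∨≡ᵇ-≤ᵇ (suc m) (suc x) c m≢x = trans (<ᵇ∨≡ᵇ-≤ᵇ m x c (m≢x ∘ cong suc)) (≤ᵇ-suc m x)
    where
    ≤ᵇ-suc : ∀ m x → (m ≤ᵇ x) ≡ (m <ᵇ suc x)
    ≤ᵇ-suc zero    x = refl
    ≤ᵇ-suc (suc m) x = refl

  countᵇ : {A : Set} → (A → Bool) → List A → ℕ
  countᵇ f = length ∘ filterᵇ f

  module _ {A : Set} (f : A → Bool) where

    countᵇ-∷ : ∀ q L → countᵇ f (q ∷ L) ≡ (if f q then suc (countᵇ f L) else countᵇ f L)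
    countᵇ-∷ q L with f q
    ... | true  = refl
    ... | false = refl

    countᵇ-++ : ∀ xs ys → countᵇ f (xs ++ ys) ≡ countᵇ f xs + countᵇ f ys
    countᵇ-++ xs ys = trans (cong length (LP.filter-++ _ xs ys)) (LP.length-++ (filterᵇ f xs))

    countᵇ-none : ∀ L → All (λ q → f q ≡ false) L → countᵇ f L ≡ 0
    countᵇ-none L none = cong length (LP.filter-none _ (All.map (λ fq → subst T fq) none))

    countᵇ-all : ∀ L → All (λ q → f q ≡ true) L → countᵇ f L ≡ length L
    countᵇ-all L all = cong length (LP.filter-all _ (All.map (Equivalence.from T-≡) all))

    countᵇ-≥1 : ∀ {L p} → p ∈ L → f p ≡ true → 1 ≤ countᵇ f L
    countᵇ-≥1 p∈L fp = LP.filter-some _ (Data.List.Relation.Unary.Any.map (λ { refl → Equivalence.from T-≡ fp }) p∈L)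
      where import Data.List.Relation.Unary.Any

  module _ {A : Set} where

    countᵇ-cong : ∀ (f g : A → Bool) L → All (λ q → f q ≡ g q) L → countᵇ f L ≡ countᵇ g L
    countᵇ-cong f g []      []          = refl
    countᵇ-cong f g (q ∷ L) (fq≡gq ∷ e) rewrite countᵇ-∷ f q L | countᵇ-∷ g q L | fq≡gq | countᵇ-cong f g L e = refl

    countᵇ-map : ∀ {B : Set} (g : B → Bool) (h : A → B) L → countᵇ g (map h L) ≡ countᵇ (g ∘ h) L
    countᵇ-map g h []      = refl
    countᵇ-map g h (q ∷ L) rewrite countᵇ-∷ g (h q) (map h L) | countᵇ-∷ (g ∘ h) q L | countᵇ-map g h L = refl

    countᵇ-mono : ∀ (f g : A → Bool) L → (∀ q → f q ≡ true → g q ≡ true) → countᵇ f L ≤ countᵇ g L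
    countᵇ-mono f g []      f⇒g = z≤n
    countᵇ-mono f g (q ∷ L) f⇒g with f q in fq
    ... | true rewrite f⇒g q fq = s≤s (countᵇ-mono f g L f⇒g)
    ... | false with g q
    ...   | true  = ℕP.m≤n⇒m≤1+n (countᵇ-mono f g L f⇒g)
    ...   | false = countᵇ-mono f g L f⇒g

    countᵇ-strict : ∀ (f g : A → Bool) L → (∀ q → f q ≡ true → g q ≡ true) →
                    ∀ {p} → p ∈ L → f p ≡ false → g p ≡ true → countᵇ f L < countᵇ g L
    countᵇ-strict f g (q ∷ L) f⇒g (here refl) fp gp
      rewrite countᵇ-∷ f q L | countᵇ-∷ g q L | fp | gp = s≤s (countᵇ-mono f g L f⇒g)
    countᵇ-strict f g (q ∷ L) f⇒g (there p∈L) fp gp with f q in fq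
    ... | true rewrite f⇒g q fq = s≤s (countᵇ-strict f g L f⇒g p∈L fp gp)
    ... | false with g q
    ...   | true  = ℕP.m≤n⇒m≤1+n (countᵇ-strict f g L f⇒g p∈L fp gp)
    ...   | false = countᵇ-strict f g L f⇒g p∈L fp gp

  Nonzero : ℤ → Set
  Nonzero a = isPos a ≡ not (isNeg a)

  AllNonzero : Word → Set
  AllNonzero w = ∀ {a} → a ∈ w → Nonzero a

  DistinctAbs : Word → Set
  DistinctAbs = AllPairs (λ a b → ∣ a ∣ ≢ ∣ b ∣)

  distinctAbs-++⁻ˡ : ∀ u {v} → DistinctAbs (u ++ v) → DistinctAbs u
  distinctAbs-++⁻ˡ []      _         = []
  distinctAbs-++⁻ˡ (a ∷ u) (a≉ ∷ d) = AllP.++⁻ˡ u a≉ ∷ distinctAbs-++⁻ˡ u d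

  distinctAbs-++⁻ʳ : ∀ u {v} → DistinctAbs (u ++ v) → DistinctAbs v
  distinctAbs-++⁻ʳ []      d       = d
  distinctAbs-++⁻ʳ (a ∷ u) (_ ∷ d) = distinctAbs-++⁻ʳ u d

  distinctAbs-↭ : ∀ {xs ys} → xs ↭ ys → DistinctAbs xs → DistinctAbs ys
  distinctAbs-↭ xs↭ys =
    AllPairs-resp-↭ (setoid ℤ) (λ ne → ne ∘ sym) (resp₂ (λ a b → ∣ a ∣ ≢ ∣ b ∣)) (↭⇒↭ₛ xs↭ys)

  rank : Word → ℕ → ℕ
  rank w x = countᵇ (λ b → ∣ b ∣ ≤ᵇ x) w

  rank-↭ : ∀ {xs ys} → xs ↭ ys → ∀ x → rank xs x ≡ rank ys x
  rank-↭ xs↭ys x = ↭-length (filter-↭ _ xs↭ys)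

  withSignOf : ℤ → ℕ → ℤ
  withSignOf a k = if isNeg a then ℤ.- (+ k) else + k

  relabel : Word → ℤ → ℤ
  relabel w a = withSignOf a (rank w ∣ a ∣)

  -- On words with distinct absolute values the tie-breaking by position in st never fires.
  st-distinct : ∀ w → DistinctAbs w → st w ≡ map (relabel w) w
  st-distinct w d = trans (LP.map-cong-local (All.tabulate entry≡)) (trans (LP.map-∘ L) (cong (map (relabel w)) proj₂-L))
    where
    L = zip (upTo (length w)) w
    rankPred : ℕ → ℕ → ℕ × ℤ → Bool
    rankPred i x p = (∣ proj₂ p ∣ <ᵇ x) ∨ ((∣ proj₂ p ∣ ≡ᵇ x) ∧ (proj₁ p ≤ᵇ i))

    proj₂-zip : ∀ (xs : List ℕ) (w : Word) → length w ≤ length xs → map proj₂ (zip xs w) ≡ w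
    proj₂-zip []       []      _         = refl
    proj₂-zip (x ∷ xs) []      _         = refl
    proj₂-zip (x ∷ xs) (a ∷ w) (s≤s len) = cong (a ∷_) (proj₂-zip xs w len)

    proj₂-L : map proj₂ L ≡ w
    proj₂-L = proj₂-zip (upTo (length w)) w (ℕP.≤-reflexive (sym (LP.length-applyUpTo id (length w))))

    rankPred-self : ∀ m c → c ≡ true → ((m <ᵇ m) ∨ ((m ≡ᵇ m) ∧ c)) ≡ true
    rankPred-self zero    c refl = refl
    rankPred-self (suc m) c c≡t  = rankPred-self m c c≡t

    rank-zip : ∀ L i a → DistinctAbs (map proj₂ L) → (i , a) ∈ L → countᵇ (rankPred i ∣ a ∣) L ≡ rank (map proj₂ L) ∣ a ∣
    rank-zip ((i , a) ∷ L) i a (a≉L ∷ _) (here refl)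
      rewrite countᵇ-∷ (rankPred i ∣ a ∣) (i , a) L
            | rankPred-self ∣ a ∣ (i ≤ᵇ i) (≤ᵇ-true (ℕP.≤-refl {i}))
            | countᵇ-∷ (λ b → ∣ b ∣ ≤ᵇ ∣ a ∣) a (map proj₂ L)
            | ≤ᵇ-true (ℕP.≤-refl {∣ a ∣})
      = cong suc (trans (countᵇ-cong _ _ L (All.map (λ {q} a≉q → <ᵇ∨≡ᵇ-≤ᵇ ∣ proj₂ q ∣ ∣ a ∣ _ (a≉q ∘ sym))
                                                    (AllP.map⁻ a≉L)))
                        (sym (countᵇ-map _ proj₂ L)))
    rank-zip (p ∷ L) i a (p≉L ∷ d) (there ia∈L)
      rewrite countᵇ-∷ (rankPred i ∣ a ∣) p L
            | <ᵇ∨≡ᵇ-≤ᵇ ∣ proj₂ p ∣ ∣ a ∣ (proj₁ p ≤ᵇ i) (All.lookup p≉L (∈-map⁺ proj₂ ia∈L))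
            | rank-zip L i a d ia∈L
      = sym (countᵇ-∷ (λ b → ∣ b ∣ ≤ᵇ ∣ a ∣) (proj₂ p) (map proj₂ L))

    entry≡ : ∀ {p} → p ∈ L → withSignOf (proj₂ p) (countᵇ (rankPred (proj₁ p) ∣ proj₂ p ∣) L) ≡ relabel w (proj₂ p)
    entry≡ {i , a} ia∈L = cong (withSignOf a)
      (trans (rank-zip L i a (subst DistinctAbs (sym proj₂-L) d) ia∈L) (cong (λ v → rank v ∣ a ∣) proj₂-L))

  st-↭ : ∀ {t w} → t ↭ w → DistinctAbs w → st t ≡ map (relabel w) t
  st-↭ {t} t↭w d = trans (st-distinct t (distinctAbs-↭ (↭-sym t↭w) d))
                         (LP.map-cong (λ a → cong (withSignOf a) (rank-↭ t↭w ∣ a ∣)) t)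

  rank-mono : ∀ w {x y} → x ≤ y → rank w x ≤ rank w y
  rank-mono w x≤y = countᵇ-mono _ _ w (λ q le → ≤ᵇ-true (ℕP.≤-trans (≤ᵇ-sound {∣ q ∣} le) x≤y))

  rank-strict : ∀ w {b x} → b ∈ w → x < ∣ b ∣ → rank w x < rank w ∣ b ∣
  rank-strict w {b} b∈w x<b =
    countᵇ-strict _ _ w (λ q le → ≤ᵇ-true (ℕP.≤-trans (≤ᵇ-sound {∣ q ∣} le) (ℕP.<⇒≤ x<b))) b∈w
      (≤ᵇ-false (ℕP.<⇒≱ x<b)) (≤ᵇ-true (ℕP.≤-refl {∣ b ∣}))

  rank-≥1 : ∀ w {a} → a ∈ w → 1 ≤ rank w ∣ a ∣
  rank-≥1 w {a} a∈w = countᵇ-≥1 _ a∈w (≤ᵇ-true (ℕP.≤-refl {∣ a ∣}))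

  withSignOf-abs : ∀ a k → ∣ withSignOf a k ∣ ≡ k
  withSignOf-abs (+ n)    k = refl
  withSignOf-abs -[1+ n ] k = ℤP.∣-i∣≡∣i∣ (+ k)

  withSignOf-isNeg : ∀ a {k} → 1 ≤ k → isNeg (withSignOf a k) ≡ isNeg a
  withSignOf-isNeg (+ n)    _       = refl
  withSignOf-isNeg -[1+ n ] (s≤s _) = refl

  withSignOf-isPos : ∀ a {k} → 1 ≤ k → Nonzero a → isPos (withSignOf a k) ≡ isPos a
  withSignOf-isPos (+ suc n) (s≤s _) _ = refl
  withSignOf-isPos -[1+ n ]  (s≤s _) _ = refl

  withSignOf-nonzero : ∀ a {k} → 1 ≤ k → Nonzero (withSignOf a k)
  withSignOf-nonzero (+ n)    (s≤s _) = refl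
  withSignOf-nonzero -[1+ n ] (s≤s _) = refl

  relabel-≤ᵇ : ∀ w {a b} → a ∈ w → b ∈ w → (∣ relabel w b ∣ ≤ᵇ ∣ relabel w a ∣) ≡ (∣ b ∣ ≤ᵇ ∣ a ∣)
  relabel-≤ᵇ w {a} {b} a∈w b∈w
    rewrite withSignOf-abs a (rank w ∣ a ∣) | withSignOf-abs b (rank w ∣ b ∣)
    = ≤ᵇ-reflects (rank-mono w) (rank-strict w b∈w)

  PreservesAbsOrder : (ℤ → ℤ) → Word → Set
  PreservesAbsOrder f u = ∀ {a b} → a ∈ u → b ∈ u → (∣ f b ∣ ≤ᵇ ∣ f a ∣) ≡ (∣ b ∣ ≤ᵇ ∣ a ∣)

  PreservesNeg : (ℤ → ℤ) → Word → Set
  PreservesNeg f u = ∀ {a} → a ∈ u → isNeg (f a) ≡ isNeg a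

  module _ {f : ℤ → ℤ} where

    preservesAbsOrder-injective : ∀ {u} → PreservesAbsOrder f u → ∀ {a b} → a ∈ u → b ∈ u →
                                  ∣ f a ∣ ≡ ∣ f b ∣ → ∣ a ∣ ≡ ∣ b ∣
    preservesAbsOrder-injective ord a∈u b∈u fa≡fb = ℕP.≤-antisym
      (≤ᵇ-sound (trans (sym (ord b∈u a∈u)) (≤ᵇ-true (ℕP.≤-reflexive fa≡fb))))
      (≤ᵇ-sound (trans (sym (ord a∈u b∈u)) (≤ᵇ-true (ℕP.≤-reflexive (sym fa≡fb)))))

    distinctAbs-map : ∀ {u} → DistinctAbs u → PreservesAbsOrder f u → DistinctAbs (map f u)
    distinctAbs-map []                 ord = []
    distinctAbs-map {a ∷ u} (a≉u ∷ d) ord =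
      AllP.map⁺ (All.tabulate (λ b∈u fa≡fb →
                   All.lookup a≉u b∈u (preservesAbsOrder-injective ord (here refl) (there b∈u) fa≡fb)))
      ∷ distinctAbs-map d (λ a∈u b∈u → ord (there a∈u) (there b∈u))

    st-map : ∀ {u} → DistinctAbs u → PreservesAbsOrder f u → PreservesNeg f u → st (map f u) ≡ st u
    st-map {u} d ord neg = begin
      st (map f u)                   ≡⟨ st-distinct (map f u) (distinctAbs-map d ord) ⟩
      map (relabel (map f u)) (map f u) ≡⟨ LP.map-∘ u ⟨
      map (relabel (map f u) ∘ f) u   ≡⟨ LP.map-cong-local (All.tabulate relabel-f) ⟩
      map (relabel u) u              ≡⟨ st-distinct u d ⟨
      st u                           ∎
      where
      open ≡-Reasoning
      relabel-f : ∀ {a} → a ∈ u → relabel (map f u) (f a) ≡ relabel u a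
      relabel-f {a} a∈u = trans
        (cong (withSignOf (f a)) (trans (countᵇ-map _ f u) (countᵇ-cong _ _ u (All.tabulate (ord a∈u)))))
        (cong (λ s → if s then ℤ.- (+ rank u ∣ a ∣) else + rank u ∣ a ∣) (neg a∈u))

  st-relabel : ∀ w {u} → DistinctAbs u → (∀ {a} → a ∈ u → a ∈ w) → st (map (relabel w) u) ≡ st u
  st-relabel w d u⊆w =
    st-map d (λ a∈u b∈u → relabel-≤ᵇ w (u⊆w a∈u) (u⊆w b∈u))
             (λ {a} a∈u → withSignOf-isNeg a (rank-≥1 w (u⊆w a∈u)))

  ∈-take : ∀ n {w : Word} {a} → a ∈ take n w → a ∈ w
  ∈-take n {w} a∈ = subst (_ ∈_) (LP.take++drop≡id n w) (∈-++⁺ˡ a∈)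

  ∈-drop : ∀ n {w : Word} {a} → a ∈ drop n w → a ∈ w
  ∈-drop n {w} a∈ = subst (_ ∈_) (LP.take++drop≡id n w) (∈-++⁺ʳ (take n w) a∈)

  ∈-posPart : ∀ {w a} → a ∈ posPart w → a ∈ w
  ∈-posPart a∈ = proj₁ (∈-filter⁻ _ a∈)

  prependIf : Bool → ℤ → Word → Word
  prependIf b a u = if b then a ∷ u else u

  posPart-∷ : ∀ a w → posPart (a ∷ w) ≡ prependIf (isPos a) a (posPart w)
  posPart-∷ a w with isPos a
  ... | true  = refl
  ... | false = refl

  posPart-map : ∀ f w → (∀ {a} → a ∈ w → isPos (f a) ≡ isPos a) → posPart (map f w) ≡ map f (posPart w)
  posPart-map f []      _     = refl
  posPart-map f (a ∷ w) signs with isPos (f a) | isPos a | signs (here refl)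
  ... | true  | true  | refl = cong (f a ∷_) (posPart-map f w (signs ∘ there))
  ... | false | false | refl = posPart-map f w (signs ∘ there)

  module _ {w : Word} (d : DistinctAbs w) where

    st-length : length (st w) ≡ length w
    st-length rewrite st-distinct w d = LP.length-map (relabel w) w

    st-take : ∀ n → st (take n (st w)) ≡ st (take n w)
    st-take n rewrite st-distinct w d =
      trans (cong st (LP.take-map n w)) (st-relabel w (AllPairsP.take⁺ n d) (∈-take n))

    st-drop : ∀ n → st (drop n (st w)) ≡ st (drop n w)
    st-drop n rewrite st-distinct w d =
      trans (cong st (LP.drop-map n w)) (st-relabel w (AllPairsP.drop⁺ n d) (∈-drop n))

    st-nonzero : AllNonzero (st w)
    st-nonzero b∈ rewrite st-distinct w d with ∈-map⁻ (relabel w) b∈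
    ... | a , a∈w , refl = withSignOf-nonzero a (rank-≥1 w a∈w)

    module _ (nz : AllNonzero w) where

      relabel-isPos : ∀ {a} → a ∈ w → isPos (relabel w a) ≡ isPos a
      relabel-isPos {a} a∈w = withSignOf-isPos a (rank-≥1 w a∈w) (nz a∈w)

      st-posPart : st (posPart (st w)) ≡ st (posPart w)
      st-posPart rewrite st-distinct w d =
        trans (cong st (posPart-map (relabel w) w relabel-isPos))
              (st-relabel w (AllPairsP.filter⁺ _ d) ∈-posPart)

      st-signs : map isPos (st w) ≡ map isPos w
      st-signs rewrite st-distinct w d = trans (sym (LP.map-∘ w)) (LP.map-cong-local (All.tabulate relabel-isPos))

  module _ {w : Word} (π : IsSignedPerm w) where

    private
      abs∈ : ∀ {a} → a ∈ w → ∃ λ i → i < length w × ∣ a ∣ ≡ suc i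
      abs∈ a∈w = ∈-applyUpTo⁻ suc (∈-resp-↭ π (∈-map⁺ ∣_∣ a∈w))

    signedPerm-nonzero : AllNonzero w
    signedPerm-nonzero {a} a∈w = nonzero a (proj₂ (proj₂ (abs∈ a∈w)))
      where
      nonzero : ∀ a {i} → ∣ a ∣ ≡ suc i → Nonzero a
      nonzero (+ suc n)  _ = refl
      nonzero -[1+ n ]   _ = refl

    signedPerm-bounded : ∀ {a} → a ∈ w → ∣ a ∣ ≤ length w
    signedPerm-bounded a∈w with i , i<n , a≡1+i ← abs∈ a∈w = subst (_≤ length w) (sym a≡1+i) i<n

    signedPerm-distinct : DistinctAbs w
    signedPerm-distinct = AllPairsP.map⁻ (Unique-resp-↭ (setoid ℕ) (↭⇒↭ₛ (↭-sym π))
      (UniqueP.applyUpTo⁺₁ suc (length w) (λ i<j _ → ℕP.<⇒≢ i<j ∘ ℕP.suc-injective)))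

  shift-isPos : ∀ m x → isPos (shiftL m x) ≡ isPos x
  shift-isPos m (+ zero)  = refl
  shift-isPos m (+ suc n) = refl
  shift-isPos m -[1+ n ]  = refl

  shift-nonzero : ∀ m {y} → Nonzero y → Nonzero (shiftL m y)
  shift-nonzero m {+ suc n}  _ = refl
  shift-nonzero m { -[1+ n ]} _ = refl

  shift-abs : ∀ m {y} → Nonzero y → ∣ shiftL m y ∣ ≡ ∣ y ∣ + m
  shift-abs m {+ suc n}  _ = refl
  shift-abs m { -[1+ n ]} _ = refl

  module _ (m : ℕ) {v : Word} (nz : AllNonzero v) where

    shift-preservesAbsOrder : PreservesAbsOrder (shiftL m) v
    shift-preservesAbsOrder {a} {b} a∈v b∈v rewrite shift-abs m (nz a∈v) | shift-abs m (nz b∈v) =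
      ≤ᵇ-reflects {∣ b ∣} {∣ a ∣} (ℕP.+-monoˡ-≤ m) (ℕP.+-monoˡ-< m)

    shift-allNonzero : AllNonzero (shift m v)
    shift-allNonzero y∈ with a , a∈v , refl ← ∈-map⁻ (shiftL m) y∈ = shift-nonzero m (nz a∈v)

    distinctAbs-shift : DistinctAbs v → DistinctAbs (shift m v)
    distinctAbs-shift d = distinctAbs-map d shift-preservesAbsOrder

    shift-abs> : ∀ {y} → y ∈ shift m v → m < ∣ y ∣
    shift-abs> y∈ with a , a∈v , refl ← ∈-map⁻ (shiftL m) y∈ rewrite shift-abs m (nz a∈v) =
      ℕP.+-monoˡ-≤ m (nonzero-abs≥1 (nz a∈v))
      where
      nonzero-abs≥1 : ∀ {a} → Nonzero a → 1 ≤ ∣ a ∣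
      nonzero-abs≥1 {+ suc n}  _ = s≤s z≤n
      nonzero-abs≥1 { -[1+ n ]} _ = s≤s z≤n

  withSignOf-shift : ∀ l m {b} k → Nonzero b → 1 ≤ k → withSignOf (shiftL m b) (l + k) ≡ shiftL l (withSignOf b k)
  withSignOf-shift l m {+ suc n}   (suc k) _ _ = cong +_ (ℕP.+-comm l (suc k))
  withSignOf-shift l m { -[1+ n ]} (suc k) _ _ = cong (λ z → ℤ.- (+ z)) (ℕP.+-comm l (suc k))

  module _ (m : ℕ) {u v : Word} (u≤m : ∀ {x} → x ∈ u → ∣ x ∣ ≤ m) (nzv : AllNonzero v) where

    distinctAbs-++-shift : DistinctAbs u → DistinctAbs v → DistinctAbs (u ++ shift m v)
    distinctAbs-++-shift du dv = AllPairsP.++⁺ du (distinctAbs-shift m nzv dv)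
      (All.tabulate λ x∈u → All.tabulate λ y∈ x≡y → ℕP.<⇒≱ (shift-abs> m nzv y∈) (subst (_≤ m) x≡y (u≤m x∈u)))

    relabel-++-shiftˡ : ∀ {a} → a ∈ u → relabel (u ++ shift m v) a ≡ relabel u a
    relabel-++-shiftˡ {a} a∈u = cong (withSignOf a) (trans (countᵇ-++ _ u (shift m v))
      (trans (cong (λ z → rank u ∣ a ∣ + z) (countᵇ-none _ (shift m v)
               (All.tabulate λ y∈ → ≤ᵇ-false (ℕP.<⇒≱ (ℕP.≤-<-trans (u≤m a∈u) (shift-abs> m nzv y∈))))))
             (ℕP.+-identityʳ _)))

    relabel-++-shiftʳ : ∀ {b} → b ∈ v → relabel (u ++ shift m v) (shiftL m b) ≡ shiftL (length u) (relabel v b)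
    relabel-++-shiftʳ {b} b∈v = trans (cong (withSignOf (shiftL m b)) rank-shifted)
                                      (withSignOf-shift (length u) m _ (nzv b∈v) (rank-≥1 v b∈v))
      where
      rank-shifted : rank (u ++ shift m v) ∣ shiftL m b ∣ ≡ length u + rank v ∣ b ∣
      rank-shifted = trans (countᵇ-++ _ u (shift m v)) (cong₂ _+_
        (countᵇ-all _ u (All.tabulate λ x∈u →
          ≤ᵇ-true (ℕP.<⇒≤ (ℕP.≤-<-trans (u≤m x∈u) (shift-abs> m nzv (∈-map⁺ (shiftL m) b∈v))))))
        (trans (countᵇ-map _ (shiftL m) v) (countᵇ-cong _ _ v (All.tabulate λ y∈v → shift-preservesAbsOrder m nzv b∈v y∈v))))

module SignAutomaton where

  open Standardisation using (Nonzero; AllNonzero; prependIf; posPart-∷)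
  open import Function using (_∘_; Equivalence)
  open import Data.Bool using (Bool; true; false; _∧_; _∨_; if_then_else_)
  open import Data.Bool.Properties using (T-≡; T-∧)
  open import Data.Empty using (⊥; ⊥-elim)
  open import Data.Unit using (⊤; tt)
  open import Data.Integer using (ℤ; +_; -[1+_])
  open import Data.Nat using (ℕ; zero; suc; _+_; _∸_; _≤_; _<_; z≤n; s≤s; _≤ᵇ_; _<ᵇ_)
  import Data.Nat.Properties as ℕP
  open import Data.List using (List; []; _∷_; map; foldr; length; upTo; applyUpTo; concatMap)
  import Data.List.Properties as LP
  open import Data.List.Membership.Propositional using (_∈_)
  open import Data.List.Membership.Propositional.Properties
    using (∈-filter⁺; ∈-filter⁻; ∈-concatMap⁺; ∈-concatMap⁻; ∈-upTo⁺)
  open import Data.List.Relation.Unary.Any as Any using (here; there)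
  open import Data.Product using (∃; _×_; _,_; proj₁; proj₂)
  open import Data.Sum using (_⊎_; inj₁; inj₂)
  open import Relation.Nullary.Decidable using (T?)
  open import Relation.Binary.PropositionalEquality

  -- φ₂(π) ≠ 0 exactly when π = ı or the signs of π read (−)*(+)⁺ or (−)*(+)⁺(−); a Phase records
  -- which part of such a pattern has been read so far.
  data Phase : Set where
    start neg pos posNeg dead : Phase

  step : Phase → Bool → Phase
  step start  true  = pos
  step start  false = neg
  step neg    true  = pos
  step neg    false = neg
  step pos    true  = pos
  step pos    false = posNeg
  step posNeg _     = dead
  step dead   _     = dead

  run : Phase → Word → Phase
  run q []      = q
  run q (a ∷ w) = run (step q (isPos a)) w

  Initial : Phase → Set
  Initial start = ⊤
  Initial neg   = ⊤
  Initial _     = ⊥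

  run-dead : ∀ w → run dead w ≡ dead
  run-dead []      = refl
  run-dead (a ∷ w) = run-dead w

  run-signs : ∀ q {w w′} → map isPos w ≡ map isPos w′ → run q w ≡ run q w′
  run-signs q {[]}    {[]}     _  = refl
  run-signs q {a ∷ w} {b ∷ w′} eq rewrite LP.∷-injectiveˡ eq = run-signs _ (LP.∷-injectiveʳ eq)

  run-∷≢start : ∀ q a w → run q (a ∷ w) ≢ start
  run-∷≢start q a w = go (step q (isPos a)) (step≢start q (isPos a)) w
    where
    step≢start : ∀ q b → step q b ≢ start
    step≢start start  true  ()
    step≢start start  false ()
    step≢start neg    true  ()
    step≢start neg    false ()
    step≢start pos    true  ()
    step≢start pos    false ()
    step≢start posNeg _     ()
    step≢start dead   _     ()
    go : ∀ q → q ≢ start → ∀ w → run q w ≢ start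
    go q q≢start []      = q≢start
    go q q≢start (a ∷ w) = go (step q (isPos a)) (step≢start q (isPos a)) w

  run-posNeg≢pos : ∀ w → run posNeg w ≢ pos
  run-posNeg≢pos []      ()
  run-posNeg≢pos (a ∷ w) eq with () ← trans (sym (run-dead w)) eq

  neg⇒¬pos : ∀ {a} → Nonzero a → isNeg a ≡ true → isPos a ≡ false
  neg⇒¬pos { -[1+ n ]} _ _ = refl

  ¬pos⇒neg : ∀ {a} → Nonzero a → isPos a ≡ false → isNeg a ≡ true
  ¬pos⇒neg {+ zero}    () _
  ¬pos⇒neg { -[1+ n ]} _  _ = refl

  ∧-true⁻ : ∀ {a b} → a ∧ b ≡ true → a ≡ true × b ≡ true
  ∧-true⁻ {true} b≡true = refl , b≡true

  ∧-true⁺ : ∀ {a b} → a ≡ true → b ≡ true → a ∧ b ≡ true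
  ∧-true⁺ refl refl = refl

  leadingOk : ℕ → ℤ → Bool
  leadingOk i a = if 1 ≤ᵇ i then isNeg a else isPos a

  signOk : ℕ → ℕ → Word → ℕ → Bool
  signOk i j π k = if (k ≤ᵇ i) ∨ ((length π ∸ j) <ᵇ k) then isNeg (at π k) else isPos (at π k)

  SignsOk : ℕ → ℕ → Word → Bool
  SignsOk i j π = foldr (λ k b → signOk i j π k ∧ b) true (applyUpTo suc (length π))

  signsOk-∷ : ∀ i j a π → j ≤ length π →
              SignsOk i j (a ∷ π) ≡ leadingOk i a ∧ SignsOk (i ∸ 1) j π
  signsOk-∷ i j a π j≤n =
    cong₂ _∧_ (head i) (foldr-∧-cong (length π) (suc ∘ suc) suc (signOk i j (a ∷ π)) (signOk (i ∸ 1) j π) (signOk-suc i))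
    where
    foldr-∧-cong : ∀ n (g g′ : ℕ → ℕ) (f f′ : ℕ → Bool) → (∀ k → f (g k) ≡ f′ (g′ k)) →
                   foldr (λ k b → f k ∧ b) true (applyUpTo g n) ≡ foldr (λ k b → f′ k ∧ b) true (applyUpTo g′ n)
    foldr-∧-cong zero    g g′ f f′ eq = refl
    foldr-∧-cong (suc n) g g′ f f′ eq = cong₂ _∧_ (eq 0) (foldr-∧-cong n (g ∘ suc) (g′ ∘ suc) f f′ (eq ∘ suc))
    suc∸ : ∀ n j → j ≤ n → suc n ∸ j ≡ suc (n ∸ j)
    suc∸ n       zero    _         = refl
    suc∸ (suc n) (suc j) (s≤s j≤n) = suc∸ n j j≤n
    head : ∀ i → signOk i j (a ∷ π) 1 ≡ leadingOk i a
    head zero    rewrite suc∸ (length π) j j≤n = refl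
    head (suc i) = refl
    signOk-suc : ∀ i k → signOk i j (a ∷ π) (suc (suc k)) ≡ signOk (i ∸ 1) j π (suc k)
    signOk-suc zero    k rewrite suc∸ (length π) j j≤n = refl
    signOk-suc (suc i) k rewrite suc∸ (length π) j j≤n = refl

  signsOk-∷⁻ : ∀ i j a π → j ≤ length π → SignsOk i j (a ∷ π) ≡ true →
               leadingOk i a ≡ true × SignsOk (i ∸ 1) j π ≡ true
  signsOk-∷⁻ i j a π j≤n ok = ∧-true⁻ {leadingOk i a} (trans (sym (signsOk-∷ i j a π j≤n)) ok)

  signsOk-∷⁺ : ∀ i j a π → j ≤ length π → leadingOk i a ≡ true →
               SignsOk (i ∸ 1) j π ≡ true → SignsOk i j (a ∷ π) ≡ true
  signsOk-∷⁺ i j a π j≤n a-ok π-ok = trans (signsOk-∷ i j a π j≤n) (∧-true⁺ a-ok π-ok)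

  run-∷ : ∀ q {a} {b} w → isPos a ≡ b → run q (a ∷ w) ≡ run (step q b) w
  run-∷ q w refl = refl

  run-initial-∷ : ∀ {q a b} w → Initial q → isPos a ≡ b → run q (a ∷ w) ≡ run (step start b) w
  run-initial-∷ {start} w _ refl = refl
  run-initial-∷ {neg} {b = true}  w _ a>0 rewrite a>0 = refl
  run-initial-∷ {neg} {b = false} w _ a<0 rewrite a<0 = refl

  positives⇒run-pos : ∀ π → SignsOk 0 0 π ≡ true → run pos π ≡ pos
  positives⇒run-pos []      _  = refl
  positives⇒run-pos (a ∷ π) ok =
    let a>0 , π-ok = signsOk-∷⁻ 0 0 a π z≤n ok in trans (run-∷ pos π a>0) (positives⇒run-pos π π-ok)

  positivesNeg⇒run-pos : ∀ π → AllNonzero π → 1 ≤ length π → SignsOk 0 1 π ≡ true → run pos π ≡ posNeg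
  positivesNeg⇒run-pos (a ∷ []) nz _ ok =
    run-∷ pos [] (neg⇒¬pos (nz (here refl)) (proj₁ (∧-true⁻ {isNeg a} ok)))
  positivesNeg⇒run-pos (a ∷ π@(_ ∷ _)) nz _ ok =
    let a>0 , π-ok = signsOk-∷⁻ 0 1 a π (s≤s z≤n) ok
    in trans (run-∷ pos π a>0) (positivesNeg⇒run-pos π (nz ∘ there) (s≤s z≤n) π-ok)

  signsOk₀⇒run-pos : ∀ {q} i π → Initial q → AllNonzero π → SignsOk i 0 π ≡ true → i < length π → run q π ≡ pos
  signsOk₀⇒run-pos zero (a ∷ π) init nz ok _ =
    let a>0 , π-ok = signsOk-∷⁻ 0 0 a π z≤n ok
    in trans (run-initial-∷ π init a>0) (positives⇒run-pos π π-ok)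
  signsOk₀⇒run-pos (suc i) (a ∷ π) init nz ok (s≤s i<n) =
    let a<0 , π-ok = signsOk-∷⁻ (suc i) 0 a π z≤n ok
    in trans (run-initial-∷ π init (neg⇒¬pos (nz (here refl)) a<0)) (signsOk₀⇒run-pos i π tt (nz ∘ there) π-ok i<n)

  signsOk₁⇒run-posNeg : ∀ {q} i π → Initial q → AllNonzero π → SignsOk i 1 π ≡ true → suc i < length π → run q π ≡ posNeg
  signsOk₁⇒run-posNeg zero (a ∷ π@(_ ∷ _)) init nz ok _ =
    let a>0 , π-ok = signsOk-∷⁻ 0 1 a π (s≤s z≤n) ok
    in trans (run-initial-∷ π init a>0) (positivesNeg⇒run-pos π (nz ∘ there) (s≤s z≤n) π-ok)
  signsOk₁⇒run-posNeg (suc i) (a ∷ π@(_ ∷ _)) init nz ok (s≤s i<n) =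
    let a<0 , π-ok = signsOk-∷⁻ (suc i) 1 a π (s≤s z≤n) ok
    in trans (run-initial-∷ π init (neg⇒¬pos (nz (here refl)) a<0)) (signsOk₁⇒run-posNeg i π tt (nz ∘ there) π-ok i<n)
  signsOk₁⇒run-posNeg i (a ∷ []) _ _ _ (s≤s ())

  signCase : ∀ a → isPos a ≡ true ⊎ isPos a ≡ false
  signCase a with isPos a
  ... | true  = inj₁ refl
  ... | false = inj₂ refl

  run-pos⇒positives : ∀ π → run pos π ≡ pos → SignsOk 0 0 π ≡ true
  run-pos⇒positives []      _ = refl
  run-pos⇒positives (a ∷ π) e with signCase a
  ... | inj₁ a>0 = signsOk-∷⁺ 0 0 a π z≤n a>0 (run-pos⇒positives π (trans (sym (run-∷ pos π a>0)) e))
  ... | inj₂ a<0 = ⊥-elim (run-posNeg≢pos π (trans (sym (run-∷ pos π a<0)) e))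

  run-pos⇒positivesNeg : ∀ π → AllNonzero π → run pos π ≡ posNeg → 1 ≤ length π × SignsOk 0 1 π ≡ true
  run-pos⇒positivesNeg []      _  ()
  run-pos⇒positivesNeg (a ∷ π) nz e with signCase a
  ... | inj₁ a>0 = let 1≤n , ok = run-pos⇒positivesNeg π (nz ∘ there) (trans (sym (run-∷ pos π a>0)) e)
                   in s≤s z≤n , signsOk-∷⁺ 0 1 a π 1≤n a>0 ok
  ... | inj₂ a<0 = lastNeg π (trans (sym (run-∷ pos π a<0)) e)
    where
    lastNeg : ∀ π → run posNeg π ≡ posNeg → 1 ≤ length (a ∷ π) × SignsOk 0 1 (a ∷ π) ≡ true
    lastNeg []       _ = s≤s z≤n , ∧-true⁺ (¬pos⇒neg (nz (here refl)) a<0) refl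
    lastNeg (b ∷ π′) e with () ← trans (sym (run-dead π′)) e

  run⇒signsOk₀ : ∀ {q} π → Initial q → AllNonzero π → run q π ≡ pos → ∃ λ i → i < length π × SignsOk i 0 π ≡ true
  run⇒signsOk₀ {start} [] _ _ ()
  run⇒signsOk₀ {neg}   [] _ _ ()
  run⇒signsOk₀ (a ∷ π) init nz e with signCase a
  ... | inj₁ a>0 = 0 , s≤s z≤n , signsOk-∷⁺ 0 0 a π z≤n a>0 (run-pos⇒positives π (trans (sym (run-initial-∷ π init a>0)) e))
  ... | inj₂ a<0 =
    let i , i<n , ok = run⇒signsOk₀ π tt (nz ∘ there) (trans (sym (run-initial-∷ π init a<0)) e)
    in suc i , s≤s i<n , signsOk-∷⁺ (suc i) 0 a π z≤n (¬pos⇒neg (nz (here refl)) a<0) ok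

  run⇒signsOk₁ : ∀ {q} π → Initial q → AllNonzero π → run q π ≡ posNeg → ∃ λ i → suc i < length π × SignsOk i 1 π ≡ true
  run⇒signsOk₁ {start} [] _ _ ()
  run⇒signsOk₁ {neg}   [] _ _ ()
  run⇒signsOk₁ (a ∷ π) init nz e with signCase a
  ... | inj₁ a>0 =
    let 1≤n , ok = run-pos⇒positivesNeg π (nz ∘ there) (trans (sym (run-initial-∷ π init a>0)) e)
    in 0 , s≤s 1≤n , signsOk-∷⁺ 0 1 a π 1≤n a>0 ok
  ... | inj₂ a<0 =
    let i , i<n , ok = run⇒signsOk₁ π tt (nz ∘ there) (trans (sym (run-initial-∷ π init a<0)) e)
    in suc i , s≤s i<n , signsOk-∷⁺ (suc i) 1 a π (ℕP.≤-trans (s≤s z≤n) (ℕP.<⇒≤ i<n)) (¬pos⇒neg (nz (here refl)) a<0) ok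

  module _ (π : Word) (nz : AllNonzero π) where

    private
      isWitness? = T? ∘ λ (p : ℕ × ℕ) → cond (proj₁ p) (proj₂ p) π

      pairs : ℕ → List (ℕ × ℕ)
      pairs i = (i , 0) ∷ (i , 1) ∷ []

      candidate-j : ∀ {i j} xs → (i , j) ∈ concatMap pairs xs → j ≡ 0 ⊎ j ≡ 1
      candidate-j xs ij∈ with _ , ij∈pairs ← Any.satisfied (∈-concatMap⁻ pairs {xs = xs} ij∈) with ij∈pairs
      ... | here refl         = inj₁ refl
      ... | there (here refl) = inj₂ refl

      witness⁺ : ∀ {i j} → j ≡ 0 ⊎ j ≡ 1 → i + j < length π → SignsOk i j π ≡ true → (i , j) ∈ witnesses π
      witness⁺ {i} {j} j01 i+j<n ok = ∈-filter⁺ isWitness? (∈-concatMap⁺ pairs (Any.map (pick j01) (∈-upTo⁺ i<1+n)))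
        (Equivalence.from T-∧ (ℕP.<⇒<ᵇ i+j<n , Equivalence.from T-≡ ok))
        where
        i<1+n = s≤s (ℕP.≤-trans (ℕP.m≤m+n i j) (ℕP.<⇒≤ i+j<n))
        pick : ∀ {j k} → j ≡ 0 ⊎ j ≡ 1 → i ≡ k → (i , j) ∈ pairs k
        pick (inj₁ refl) refl = here refl
        pick (inj₂ refl) refl = there (here refl)

    witness-sound : ∀ {i j} → (i , j) ∈ witnesses π → (j ≡ 0 × run start π ≡ pos) ⊎ (j ≡ 1 × run start π ≡ posNeg)
    witness-sound {i} {j} ij∈
      with ij∈cands , holds ← ∈-filter⁻ isWitness? {xs = concatMap pairs (upTo (suc (length π)))} ij∈
      with i+j<ᵇn , ok ← Equivalence.to (T-∧ {(i + j) <ᵇ length π} {SignsOk i j π}) holds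
      with candidate-j (upTo (suc (length π))) ij∈cands
    ... | inj₁ refl = inj₁ (refl , signsOk₀⇒run-pos i π tt nz (Equivalence.to T-≡ ok)
                                     (subst (_< length π) (ℕP.+-identityʳ i) (ℕP.<ᵇ⇒< _ _ i+j<ᵇn)))
    ... | inj₂ refl = inj₂ (refl , signsOk₁⇒run-posNeg i π tt nz (Equivalence.to T-≡ ok)
                                     (subst (_< length π) (ℕP.+-comm i 1) (ℕP.<ᵇ⇒< _ _ i+j<ᵇn)))

    witnesses-complete : run start π ≡ pos ⊎ run start π ≡ posNeg → witnesses π ≢ []
    witnesses-complete (inj₁ e) none with i , i<n , ok ← run⇒signsOk₀ π tt nz e
      with () ← subst ((i , 0) ∈_) none (witness⁺ (inj₁ refl) (subst (_< length π) (sym (ℕP.+-identityʳ i)) i<n) ok)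
    witnesses-complete (inj₂ e) none with i , i<n , ok ← run⇒signsOk₁ π tt nz e
      with () ← subst ((i , 1) ∈_) none (witness⁺ (inj₂ refl) (subst (_< length π) (ℕP.+-comm 1 i) i<n) ok)

  run-negatives : ∀ {q} a w → Initial q → posPart (a ∷ w) ≡ [] → run q (a ∷ w) ≡ neg
  run-negatives {q} a w init noPos with signCase a
  ... | inj₁ a>0 with () ← trans (sym noPos) (trans (posPart-∷ a w) (cong (λ b → prependIf b a (posPart w)) a>0))
  ... | inj₂ a<0 = trans (run-initial-∷ w init a<0)
                         (run-neg w (trans (sym (trans (posPart-∷ a w) (cong (λ b → prependIf b a (posPart w)) a<0))) noPos))
    where
    run-neg : ∀ w → posPart w ≡ [] → run neg w ≡ neg
    run-neg []      _     = refl
    run-neg (b ∷ w) noPos = run-negatives b w tt noPos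

module FormalSums {c ℓ} (K : CommutativeRing c ℓ) where

  open import Function using (_∘_)
  open import Data.Bool using (not; if_then_else_)
  open import Data.Nat using (suc; _≤_; s≤s)
  import Data.Nat.Properties as ℕP
  open import Data.List using ([]; _∷_; _++_; map; foldr; concatMap; length; filterᵇ)
  import Data.List.Properties as LP
  open import Data.List.Relation.Unary.All as All using (All; []; _∷_)
  open import Data.Product using (_,_; proj₁; proj₂)
  open import Relation.Nullary using (Dec; yes; no; ¬_)
  open import Data.Empty using (⊥-elim)
  open import Relation.Nullary.Decidable using (⌊_⌋)
  open import Relation.Binary.Definitions using (DecidableEquality)
  open import Relation.Binary.Bundles using (Setoid)
  import Relation.Binary.Reasoning.Setoid
  open import Relation.Binary.PropositionalEquality as Eq using (_≡_)

  open CommutativeRing K renaming (Carrier to 𝐤)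
  open WithRing K using (FS; scale; linExt; bilinExt; basis)
  open import Algebra.Properties.Ring ring using (-1*x≈-x)
  open import Algebra.Properties.Group +-group using (x∙y⁻¹≈ε⇒x≈y)
  open import Algebra.Properties.CommutativeSemigroup +-commutativeSemigroup
    using () renaming (interchange to +-interchange; x∙yz≈y∙xz to +-swapˡ)
  open import Algebra.Properties.CommutativeSemigroup *-commutativeSemigroup using () renaming (x∙yz≈y∙xz to *-swapˡ)
  open import Relation.Binary.Reasoning.Setoid setoid

  mapBasis : {B B′ : Set} → (B → B′) → FS B → FS B′
  mapBasis g = map (λ t → (proj₁ t , g (proj₂ t)))

  scale-mapBasis : ∀ {B B′ : Set} k (g : B → B′) x → scale k (mapBasis g x) ≡ mapBasis g (scale k x)
  scale-mapBasis k g x = Eq.trans (Eq.sym (LP.map-∘ x)) (LP.map-∘ x)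

  linExt-mapBasis : ∀ {A B C : Set} (f : B → FS C) (g : A → B) x → linExt f (mapBasis g x) ≡ linExt (f ∘ g) x
  linExt-mapBasis f g []      = Eq.refl
  linExt-mapBasis f g (t ∷ x) = Eq.cong (scale (proj₁ t) (f (g (proj₂ t))) ++_) (linExt-mapBasis f g x)

  linExt-singletons : ∀ {A B : Set} (k : A → 𝐤) (g : A → B) x →
                      linExt (λ a → (k a , g a) ∷ []) x ≡ map (λ t → (proj₁ t * k (proj₂ t) , g (proj₂ t))) x
  linExt-singletons k g []      = Eq.refl
  linExt-singletons k g (t ∷ x) = Eq.cong (_ ∷_) (linExt-singletons k g x)

  scale-++ : ∀ {B : Set} k (x y : FS B) → scale k (x ++ y) ≡ scale k x ++ scale k y
  scale-++ k = LP.map-++ _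

  sumWith : {B : Set} → (B → 𝐤) → FS B → 𝐤
  sumWith h = foldr (λ t s → proj₁ t * h (proj₂ t) + s) 0#

  sumWith-mapBasis : ∀ {A B : Set} (h : B → 𝐤) (g : A → B) x → sumWith h (mapBasis g x) ≡ sumWith (h ∘ g) x
  sumWith-mapBasis h g []      = Eq.refl
  sumWith-mapBasis h g (t ∷ x) = Eq.cong (proj₁ t * h (g (proj₂ t)) +_) (sumWith-mapBasis h g x)

  module _ {B : Set} where

    sumWith-++ : ∀ (h : B → 𝐤) x y → sumWith h (x ++ y) ≈ sumWith h x + sumWith h y
    sumWith-++ h []      y = sym (+-identityˡ _)
    sumWith-++ h (t ∷ x) y = trans (+-congˡ (sumWith-++ h x y)) (sym (+-assoc _ _ _))

    sumWith-scale : ∀ (h : B → 𝐤) k x → sumWith h (scale k x) ≈ k * sumWith h x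
    sumWith-scale h k []      = sym (zeroʳ k)
    sumWith-scale h k (t ∷ x) =
      trans (+-cong (*-assoc _ _ _) (sumWith-scale h k x)) (sym (distribˡ k _ _))

    sumWith-congAll : ∀ {h h′ : B → 𝐤} x → All (λ t → h (proj₂ t) ≈ h′ (proj₂ t)) x → sumWith h x ≈ sumWith h′ x
    sumWith-congAll []      []       = refl
    sumWith-congAll (t ∷ x) (e ∷ es) = +-cong (*-congˡ e) (sumWith-congAll x es)

    sumWith-cong : ∀ {h h′ : B → 𝐤} x → (∀ b → h b ≈ h′ b) → sumWith h x ≈ sumWith h′ x
    sumWith-cong x e = sumWith-congAll x (All.universal (λ t → e (proj₂ t)) x)

    sumWith-zero : ∀ (x : FS B) → sumWith (λ _ → 0#) x ≈ 0#
    sumWith-zero []      = refl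
    sumWith-zero (t ∷ x) = trans (+-cong (zeroʳ _) (sumWith-zero x)) (+-identityˡ 0#)

    sumWith-+ : ∀ (h g : B → 𝐤) x → sumWith (λ b → h b + g b) x ≈ sumWith h x + sumWith g x
    sumWith-+ h g []      = sym (+-identityˡ 0#)
    sumWith-+ h g (t ∷ x) = trans (+-cong (distribˡ _ _ _) (sumWith-+ h g x)) (+-interchange _ _ _ _)

    sumWith-*ˡ : ∀ k (h : B → 𝐤) x → sumWith (λ b → k * h b) x ≈ k * sumWith h x
    sumWith-*ˡ k h []      = sym (zeroʳ k)
    sumWith-*ˡ k h (t ∷ x) = trans (+-cong (*-swapˡ _ _ _) (sumWith-*ˡ k h x)) (sym (distribˡ k _ _))

  sumWith-linExt : ∀ {A B : Set} (h : B → 𝐤) (f : A → FS B) x → sumWith h (linExt f x) ≈ sumWith (sumWith h ∘ f) x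
  sumWith-linExt h f []      = refl
  sumWith-linExt h f (t ∷ x) =
    trans (sumWith-++ h (scale (proj₁ t) (f (proj₂ t))) (linExt f x))
          (+-cong (sumWith-scale h (proj₁ t) (f (proj₂ t))) (sumWith-linExt h f x))

  sumWith-bilinExt : ∀ {A B C : Set} (h : C → 𝐤) (f : A → B → FS C) x y →
                     sumWith h (bilinExt f x y) ≈ sumWith (λ a → sumWith (λ b → sumWith h (f a b)) y) x
  sumWith-bilinExt             h f []      y = refl
  sumWith-bilinExt {B = B} {C} h f (s ∷ x) y =
    trans (sumWith-++ h (row y) (bilinExt f x y)) (+-cong (sumWith-row y) (sumWith-bilinExt h f x y))
    where
    row : FS B → FS C
    row = concatMap (λ t → scale (proj₁ s * proj₁ t) (f (proj₂ s) (proj₂ t)))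
    sumWith-row : ∀ y → sumWith h (row y) ≈ proj₁ s * sumWith (λ b → sumWith h (f (proj₂ s) b)) y
    sumWith-row []      = sym (zeroʳ _)
    sumWith-row (t ∷ y) = begin
      sumWith h (scale (proj₁ s * proj₁ t) (f (proj₂ s) (proj₂ t)) ++ row y)
        ≈⟨ sumWith-++ h (scale (proj₁ s * proj₁ t) (f (proj₂ s) (proj₂ t))) (row y) ⟩
      sumWith h (scale (proj₁ s * proj₁ t) (f (proj₂ s) (proj₂ t))) + sumWith h (row y)
        ≈⟨ +-cong (trans (sumWith-scale h _ (f (proj₂ s) (proj₂ t))) (*-assoc _ _ _)) (sumWith-row y) ⟩
      proj₁ s * (proj₁ t * sumWith h (f (proj₂ s) (proj₂ t))) + proj₁ s * sumWith (λ b → sumWith h (f (proj₂ s) b)) y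
        ≈⟨ distribˡ _ _ _ ⟨
      proj₁ s * (proj₁ t * sumWith h (f (proj₂ s) (proj₂ t)) + sumWith (λ b → sumWith h (f (proj₂ s) b)) y) ∎

  sumWith-swap : ∀ {A B : Set} (F : A → B → 𝐤) x y →
                 sumWith (λ a → sumWith (F a) y) x ≈ sumWith (λ b → sumWith (λ a → F a b) x) y
  sumWith-swap F []      y = sym (sumWith-zero y)
  sumWith-swap F (s ∷ x) y =
    trans (+-cong (sym (sumWith-*ˡ _ _ y)) (sumWith-swap F x y)) (sym (sumWith-+ _ _ y))

  module Coefficients {B : Set} (_≟_ : DecidableEquality B) where

    indicator : B → B → 𝐤
    indicator w b = if ⌊ b ≟ w ⌋ then 1# else 0#

    coefficient : FS B → B → 𝐤
    coefficient x w = foldr (λ t s → (if ⌊ proj₂ t ≟ w ⌋ then proj₁ t else 0#) + s) 0# x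

    infix 4 _≋_
    record _≋_ (x y : FS B) : Set ℓ where
      constructor mk≋
      field ≋-coefficient : ∀ w → coefficient x w ≈ coefficient y w
    open _≋_ public

    ≋-refl : ∀ {x} → x ≋ x
    ≋-refl = mk≋ λ _ → refl

    ≋-sym : ∀ {x y} → x ≋ y → y ≋ x
    ≋-sym x≋y = mk≋ λ w → sym (≋-coefficient x≋y w)

    ≋-trans : ∀ {x y z} → x ≋ y → y ≋ z → x ≋ z
    ≋-trans x≋y y≋z = mk≋ λ w → trans (≋-coefficient x≋y w) (≋-coefficient y≋z w)

    ≡⇒≋ : ∀ {x y} → x ≡ y → x ≋ y
    ≡⇒≋ Eq.refl = ≋-refl

    ≋-setoid : Setoid c ℓ
    ≋-setoid = record
      { Carrier = FS B ; _≈_ = _≋_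
      ; isEquivalence = record { refl = ≋-refl ; sym = ≋-sym ; trans = ≋-trans } }

    module ≋-Reasoning where
      open Relation.Binary.Reasoning.Setoid ≋-setoid public hiding (start)

    coefficient-sumWith : ∀ x w → coefficient x w ≈ sumWith (indicator w) x
    coefficient-sumWith []            w = refl
    coefficient-sumWith ((k , b) ∷ x) w with b ≟ w
    ... | yes _ = +-cong (sym (*-identityʳ k)) (coefficient-sumWith x w)
    ... | no  _ = +-cong (sym (zeroʳ k)) (coefficient-sumWith x w)

    coefficient-++ : ∀ x y w → coefficient (x ++ y) w ≈ coefficient x w + coefficient y w
    coefficient-++ []      y w = sym (+-identityˡ _)
    coefficient-++ (t ∷ x) y w = trans (+-congˡ (coefficient-++ x y w)) (sym (+-assoc _ _ _))

    coefficient-scale : ∀ k x w → coefficient (scale k x) w ≈ k * coefficient x w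
    coefficient-scale k x w = trans (coefficient-sumWith (scale k x) w)
      (trans (sumWith-scale (indicator w) k x) (*-congˡ (sym (coefficient-sumWith x w))))

    ++-cong : ∀ {x x′ y y′} → x ≋ x′ → y ≋ y′ → x ++ y ≋ x′ ++ y′
    ++-cong {x} {x′} {y} {y′} x≋x′ y≋y′ = mk≋ λ w →
      trans (coefficient-++ x y w) (trans (+-cong (≋-coefficient x≋x′ w) (≋-coefficient y≋y′ w)) (sym (coefficient-++ x′ y′ w)))

    ++-[] : ∀ x → x ++ [] ≋ x
    ++-[] x = ≡⇒≋ (LP.++-identityʳ x)

    scale-cong : ∀ {k k′ x y} → k ≈ k′ → x ≋ y → scale k x ≋ scale k′ y
    scale-cong {k} {k′} {x} {y} k≈k′ x≋y = mk≋ λ w →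
      trans (coefficient-scale k x w) (trans (*-cong k≈k′ (≋-coefficient x≋y w)) (sym (coefficient-scale k′ y w)))

    scale-scale : ∀ k k′ x → scale k (scale k′ x) ≋ scale (k * k′) x
    scale-scale k k′ x = mk≋ λ w → trans (coefficient-scale k (scale k′ x) w)
      (trans (*-congˡ (coefficient-scale k′ x w)) (trans (sym (*-assoc k k′ _)) (sym (coefficient-scale (k * k′) x w))))

    scale-1 : ∀ x → scale 1# x ≋ x
    scale-1 x = mk≋ λ w → trans (coefficient-scale 1# x w) (*-identityˡ _)

    scale-zero : ∀ {k} x → k ≈ 0# → scale k x ≋ []
    scale-zero {k} x k≈0 = mk≋ λ w → trans (coefficient-scale k x w) (trans (*-congʳ k≈0) (zeroˡ _))

    scale-+ : ∀ k k′ x → scale k x ++ scale k′ x ≋ scale (k + k′) x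
    scale-+ k k′ x = mk≋ λ w → trans (coefficient-++ (scale k x) (scale k′ x) w)
      (trans (+-cong (coefficient-scale k x w) (coefficient-scale k′ x w))
        (trans (sym (distribʳ _ k k′)) (sym (coefficient-scale (k + k′) x w))))

    cons-cong : ∀ {k k′} b {x y} → k ≈ k′ → x ≋ y → (k , b) ∷ x ≋ (k′ , b) ∷ y
    cons-cong {k} {k′} b k≈k′ x≋y = mk≋ λ w → +-cong (head w (b ≟ w)) (≋-coefficient x≋y w)
      where
      head : ∀ w d → (if ⌊ d ⌋ then k else 0#) ≈ (if ⌊ d ⌋ then k′ else 0#)
      head w (yes _) = k≈k′
      head w (no  _) = refl

    cons-zero : ∀ {k} b {x} → k ≈ 0# → (k , b) ∷ x ≋ x
    cons-zero {k} b {x} k≈0 = mk≋ λ w → trans (+-congʳ (head w (b ≟ w))) (+-identityˡ _)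
      where
      head : ∀ w d → (if ⌊ d ⌋ then k else 0#) ≈ 0#
      head w (yes _) = k≈0
      head w (no  _) = refl

    cons-merge : ∀ k k′ b x → (k , b) ∷ (k′ , b) ∷ x ≋ (k + k′ , b) ∷ x
    cons-merge k k′ b x = mk≋ λ w → trans (sym (+-assoc _ _ _)) (+-congʳ (head w (b ≟ w)))
      where
      head : ∀ w d → (if ⌊ d ⌋ then k else 0#) + (if ⌊ d ⌋ then k′ else 0#) ≈ (if ⌊ d ⌋ then k + k′ else 0#)
      head w (yes _) = refl
      head w (no  _) = +-identityˡ 0#

    private
      remove : B → FS B → FS B
      remove b = filterᵇ (λ t → not ⌊ proj₂ t ≟ b ⌋)

      if-≢ : ∀ {b′ b} (u v : 𝐤) → ¬ b′ ≡ b → (if ⌊ b′ ≟ b ⌋ then u else v) ≡ v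
      if-≢ {b′} {b} u v b′≢b with b′ ≟ b
      ... | yes b′≡b = ⊥-elim (b′≢b b′≡b)
      ... | no  _    = Eq.refl

      coefficient-remove-self : ∀ b x → coefficient (remove b x) b ≈ 0#
      coefficient-remove-self b []             = refl
      coefficient-remove-self b ((k , b′) ∷ x) with b′ ≟ b
      ... | yes _    = coefficient-remove-self b x
      ... | no  b′≢b = trans (+-congʳ (reflexive (if-≢ k 0# b′≢b))) (trans (+-identityˡ _) (coefficient-remove-self b x))

      coefficient-remove-other : ∀ {b w} x → ¬ b ≡ w → coefficient (remove b x) w ≈ coefficient x w
      coefficient-remove-other                  []             b≢w = refl
      coefficient-remove-other {b} {w} ((k , b′) ∷ x) b≢w with b′ ≟ b
      ... | no  _       = +-congˡ (coefficient-remove-other x b≢w)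
      ... | yes Eq.refl =
        trans (coefficient-remove-other x b≢w) (sym (trans (+-congʳ (reflexive (if-≢ k 0# b≢w))) (+-identityˡ _)))

      length-remove-head : ∀ k b x → length (remove b ((k , b) ∷ x)) ≤ length x
      length-remove-head k b x with b ≟ b
      ... | yes _   = LP.length-filter _ x
      ... | no  b≢b = ⊥-elim (b≢b Eq.refl)

      sumWith-split : ∀ (h : B → 𝐤) b x → sumWith h x ≈ coefficient x b * h b + sumWith h (remove b x)
      sumWith-split h b []             = sym (trans (+-congʳ (zeroˡ (h b))) (+-identityˡ 0#))
      sumWith-split h b ((k , b′) ∷ x) with b′ ≟ b
      ... | yes Eq.refl = begin
        k * h b + sumWith h x                                        ≈⟨ +-congˡ (sumWith-split h b x) ⟩
        k * h b + (coefficient x b * h b + sumWith h (remove b x))  ≈⟨ +-assoc _ _ _ ⟨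
        (k * h b + coefficient x b * h b) + sumWith h (remove b x)  ≈⟨ +-congʳ (distribʳ _ _ _) ⟨
        (k + coefficient x b) * h b + sumWith h (remove b x)        ∎
      ... | no  _       = begin
        k * h b′ + sumWith h x                                              ≈⟨ +-congˡ (sumWith-split h b x) ⟩
        k * h b′ + (coefficient x b * h b + sumWith h (remove b x))        ≈⟨ +-swapˡ _ _ _ ⟩
        coefficient x b * h b + (k * h b′ + sumWith h (remove b x))        ≈⟨ +-congʳ (*-congʳ (+-identityˡ _)) ⟨
        (0# + coefficient x b) * h b + (k * h b′ + sumWith h (remove b x)) ∎

    -- Induction on the length, removing one basis element (and all its repetitions) at a time.
    sumWith-≋[] : ∀ (h : B → 𝐤) x → x ≋ [] → sumWith h x ≈ 0#
    sumWith-≋[] h x = go (length x) x ℕP.≤-refl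
      where
      go : ∀ n x → length x ≤ n → x ≋ [] → sumWith h x ≈ 0#
      go _       []            _         _   = refl
      go (suc n) ((k , b) ∷ x) (s≤s len) x≋0 = begin
        sumWith h ((k , b) ∷ x)
          ≈⟨ sumWith-split h b ((k , b) ∷ x) ⟩
        coefficient ((k , b) ∷ x) b * h b + sumWith h (remove b ((k , b) ∷ x))
          ≈⟨ +-cong (trans (*-congʳ (≋-coefficient x≋0 b)) (zeroˡ _))
                    (go n _ (ℕP.≤-trans (length-remove-head k b x) len) (remove-≋[] x≋0)) ⟩
        0# + 0#
          ≈⟨ +-identityˡ 0# ⟩
        0# ∎
        where
        remove-≋[] : ∀ {y} → y ≋ [] → remove b y ≋ []
        remove-≋[] {y} y≋0 = mk≋ λ w → case (b ≟ w)
          where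
          case : ∀ {w} → Dec (b ≡ w) → coefficient (remove b y) w ≈ 0#
          case (yes Eq.refl) = coefficient-remove-self b y
          case (no  b≢w)     = trans (coefficient-remove-other y b≢w) (≋-coefficient y≋0 _)

    sumWith-resp : ∀ (h : B → 𝐤) {x y} → x ≋ y → sumWith h x ≈ sumWith h y
    sumWith-resp h {x} {y} x≋y = x∙y⁻¹≈ε⇒x≈y (sumWith h x) (sumWith h y) difference≈0
      where
      difference≋[] : x ++ scale (- 1#) y ≋ []
      difference≋[] = mk≋ λ w → trans (coefficient-++ x (scale (- 1#) y) w)
        (trans (+-cong (≋-coefficient x≋y w) (trans (coefficient-scale (- 1#) y w) (-1*x≈-x _))) (-‿inverseʳ _))
      difference≈0 : sumWith h x + - sumWith h y ≈ 0#
      difference≈0 = trans (+-congˡ (trans (sym (-1*x≈-x _)) (sym (sumWith-scale h (- 1#) y))))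
        (trans (sym (sumWith-++ h x (scale (- 1#) y))) (sumWith-≋[] h _ difference≋[]))

  module Linear {B : Set} (_≟_ : DecidableEquality B) where

    open Coefficients _≟_ public

    module _ {A : Set} where

      coefficient-linExt : ∀ (f : A → FS B) x w → coefficient (linExt f x) w ≈ sumWith (λ a → coefficient (f a) w) x
      coefficient-linExt f x w = trans (coefficient-sumWith (linExt f x) w)
        (trans (sumWith-linExt (indicator w) f x) (sumWith-cong x (λ a → sym (coefficient-sumWith (f a) w))))

      coefficient-mapBasis : ∀ (g : A → B) x w → coefficient (mapBasis g x) w ≈ sumWith (indicator w ∘ g) x
      coefficient-mapBasis g x w = trans (coefficient-sumWith (mapBasis g x) w) (reflexive (sumWith-mapBasis (indicator w) g x))

      linExt-cong : ∀ {f g : A → FS B} x → All (λ t → f (proj₂ t) ≋ g (proj₂ t)) x → linExt f x ≋ linExt g x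
      linExt-cong {f} {g} x f≋g = mk≋ λ w → trans (coefficient-linExt f x w)
        (trans (sumWith-congAll x (All.map (λ e → ≋-coefficient e w) f≋g)) (sym (coefficient-linExt g x w)))

      linExt-single : ∀ (f : A → FS B) k a → linExt f ((k , a) ∷ []) ≋ scale k (f a)
      linExt-single f k a = ++-[] (scale k (f a))

      module _ (_≟A_ : DecidableEquality A) where
        private module A = Coefficients _≟A_

        linExt-resp : ∀ (f : A → FS B) {x y} → x A.≋ y → linExt f x ≋ linExt f y
        linExt-resp f {x} {y} x≋y = mk≋ λ w → trans (coefficient-linExt f x w)
          (trans (A.sumWith-resp (λ a → coefficient (f a) w) x≋y) (sym (coefficient-linExt f y w)))

        mapBasis-resp : ∀ (g : A → B) {x y} → x A.≋ y → mapBasis g x ≋ mapBasis g y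
        mapBasis-resp g {x} {y} x≋y = mk≋ λ w → trans (coefficient-mapBasis g x w)
          (trans (A.sumWith-resp (indicator w ∘ g) x≋y) (sym (coefficient-mapBasis g y w)))

    linExt-∘ : ∀ {A C : Set} (f : C → FS B) (g : A → FS C) x → linExt f (linExt g x) ≋ linExt (linExt f ∘ g) x
    linExt-∘ f g x = mk≋ λ w → begin
      coefficient (linExt f (linExt g x)) w          ≈⟨ coefficient-linExt f (linExt g x) w ⟩
      sumWith (λ c → coefficient (f c) w) (linExt g x) ≈⟨ sumWith-linExt _ g x ⟩
      sumWith (λ a → sumWith (λ c → coefficient (f c) w) (g a)) x
        ≈⟨ sumWith-cong x (λ a → sym (coefficient-linExt f (g a) w)) ⟩
      sumWith (λ a → coefficient (linExt f (g a)) w) x  ≈⟨ coefficient-linExt (linExt f ∘ g) x w ⟨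
      coefficient (linExt (linExt f ∘ g) x) w        ∎

    coefficient-bilinExt : ∀ {A A′ : Set} (f : A → A′ → FS B) x y w →
      coefficient (bilinExt f x y) w ≈ sumWith (λ a → sumWith (λ a′ → coefficient (f a a′) w) y) x
    coefficient-bilinExt f x y w = trans (coefficient-sumWith (bilinExt f x y) w)
      (trans (sumWith-bilinExt (indicator w) f x y)
        (sumWith-cong x (λ a → sumWith-cong y (λ a′ → sym (coefficient-sumWith (f a a′) w)))))

    module _ {A A′ : Set} where

      bilinExt-cong : ∀ {f g : A → A′ → FS B} x y →
        All (λ s → All (λ t → f (proj₂ s) (proj₂ t) ≋ g (proj₂ s) (proj₂ t)) y) x → bilinExt f x y ≋ bilinExt g x y
      bilinExt-cong {f} {g} x y f≋g = mk≋ λ w → trans (coefficient-bilinExt f x y w)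
        (trans (sumWith-congAll x (All.map (λ row → sumWith-congAll y (All.map (λ e → ≋-coefficient e w) row)) f≋g))
          (sym (coefficient-bilinExt g x y w)))

      bilinExt-resp : ∀ (_≟A_ : DecidableEquality A) (_≟A′_ : DecidableEquality A′) (f : A → A′ → FS B) {x x′ y y′} →
        Coefficients._≋_ _≟A_ x x′ → Coefficients._≋_ _≟A′_ y y′ → bilinExt f x y ≋ bilinExt f x′ y′
      bilinExt-resp _≟A_ _≟A′_ f {x} {x′} {y} {y′} x≋x′ y≋y′ = mk≋ λ w → begin
        coefficient (bilinExt f x y) w ≈⟨ coefficient-bilinExt f x y w ⟩
        sumWith (λ a → sumWith (λ a′ → coefficient (f a a′) w) y) x
          ≈⟨ sumWith-cong x (λ a → Coefficients.sumWith-resp _≟A′_ _ y≋y′) ⟩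
        sumWith (λ a → sumWith (λ a′ → coefficient (f a a′) w) y′) x
          ≈⟨ Coefficients.sumWith-resp _≟A_ _ x≋x′ ⟩
        sumWith (λ a → sumWith (λ a′ → coefficient (f a a′) w) y′) x′ ≈⟨ coefficient-bilinExt f x′ y′ w ⟨
        coefficient (bilinExt f x′ y′) w ∎

      linExt-bilinExt : ∀ {C : Set} (f : C → FS B) (h : A → A′ → FS C) x y →
        linExt f (bilinExt h x y) ≋ bilinExt (λ a a′ → linExt f (h a a′)) x y
      linExt-bilinExt f h x y = mk≋ λ w → begin
        coefficient (linExt f (bilinExt h x y)) w ≈⟨ coefficient-linExt f (bilinExt h x y) w ⟩
        sumWith (λ c → coefficient (f c) w) (bilinExt h x y) ≈⟨ sumWith-bilinExt _ h x y ⟩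
        sumWith (λ a → sumWith (λ a′ → sumWith (λ c → coefficient (f c) w) (h a a′)) y) x
          ≈⟨ sumWith-cong x (λ a → sumWith-cong y (λ a′ → sym (coefficient-linExt f (h a a′) w))) ⟩
        sumWith (λ a → sumWith (λ a′ → coefficient (linExt f (h a a′)) w) y) x
          ≈⟨ coefficient-bilinExt (λ a a′ → linExt f (h a a′)) x y w ⟨
        coefficient (bilinExt (λ a a′ → linExt f (h a a′)) x y) w ∎

      bilinExt-linExt : ∀ {C C′ : Set} (g : C → C′ → FS B) (φ : A → FS C) (ψ : A′ → FS C′) x y →
        bilinExt g (linExt φ x) (linExt ψ y) ≋ bilinExt (λ a a′ → bilinExt g (φ a) (ψ a′)) x y
      bilinExt-linExt g φ ψ x y = mk≋ λ w → begin
        coefficient (bilinExt g (linExt φ x) (linExt ψ y)) w ≈⟨ coefficient-bilinExt g (linExt φ x) (linExt ψ y) w ⟩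
        sumWith (λ c → sumWith (λ c′ → coefficient (g c c′) w) (linExt ψ y)) (linExt φ x) ≈⟨ sumWith-linExt _ φ x ⟩
        sumWith (λ a → sumWith (λ c → sumWith (λ c′ → coefficient (g c c′) w) (linExt ψ y)) (φ a)) x
          ≈⟨ sumWith-cong x (λ a → sumWith-cong (φ a) (λ c → sumWith-linExt (λ c′ → coefficient (g c c′) w) ψ y)) ⟩
        sumWith (λ a → sumWith (λ c → sumWith (λ a′ → sumWith (λ c′ → coefficient (g c c′) w) (ψ a′)) y) (φ a)) x
          ≈⟨ sumWith-cong x (λ a → sumWith-swap (λ c a′ → sumWith (λ c′ → coefficient (g c c′) w) (ψ a′)) (φ a) y) ⟩
        sumWith (λ a → sumWith (λ a′ → sumWith (λ c → sumWith (λ c′ → coefficient (g c c′) w) (ψ a′)) (φ a)) y) x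
          ≈⟨ sumWith-cong x (λ a → sumWith-cong y (λ a′ → sym (coefficient-bilinExt g (φ a) (ψ a′) w))) ⟩
        sumWith (λ a → sumWith (λ a′ → coefficient (bilinExt g (φ a) (ψ a′)) w) y) x
          ≈⟨ coefficient-bilinExt (λ a a′ → bilinExt g (φ a) (ψ a′)) x y w ⟨
        coefficient (bilinExt (λ a a′ → bilinExt g (φ a) (ψ a′)) x y) w ∎

module Phi₂Basis {c ℓ} (K : CommutativeRing c ℓ) where

  open Standardisation
  open SignAutomaton
  open import Data.Bool using (if_then_else_)
  open import Data.Empty using (⊥-elim)
  open import Data.Unit using (tt)
  open import Data.List using ([]; _∷_; null)
  open import Data.List.Membership.Propositional using (_∈_)
  open import Data.List.Relation.Unary.Any using (here)
  import Data.List.Relation.Unary.All as All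
  open import Data.Product using (_,_)
  open import Data.Sum using (inj₁; inj₂)
  open import Relation.Binary.PropositionalEquality as Eq using (_≡_; _≢_)

  open CommutativeRing K renaming (Carrier to 𝐤)
  open WithRing K using (FS; IsHSym; φ₂-basis; φ₂; ε; unit)
  open import Algebra.Properties.Ring ring using (-0#≈0#)
  open FormalSums K
  open Linear wordEq?

  value : Phase → 𝐤
  value start  = 1#
  value neg    = 0#
  value pos    = 1#
  value posNeg = - 1#
  value dead   = 0#

  weight : Phase → Word → 𝐤
  weight q w = value (run q w)

  isEmpty : Word → 𝐤
  isEmpty w = if null w then 1# else 0#

  weight-neg-∷ : ∀ b w → weight neg (b ∷ w) ≡ weight start (b ∷ w)
  weight-neg-∷ b w = Eq.cong value (run-initial-∷ w tt Eq.refl)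

  weight-neg : ∀ w → weight neg w ≈ weight start w + - isEmpty w
  weight-neg []      = sym (-‿inverseʳ 1#)
  weight-neg (b ∷ w) = trans (reflexive (weight-neg-∷ b w)) (sym (trans (+-congˡ -0#≈0#) (+-identityʳ _)))

  weight-posNeg : ∀ w → weight posNeg w ≈ - isEmpty w
  weight-posNeg []      = refl
  weight-posNeg (b ∷ w) = trans (reflexive (Eq.cong value (run-dead w))) (sym -0#≈0#)

  weight-dead : ∀ w → weight dead w ≈ 0#
  weight-dead w = reflexive (Eq.cong value (run-dead w))

  weight-neg-positive : ∀ w → posPart w ≢ [] → weight neg w ≈ weight start w
  weight-neg-positive []      noPos = ⊥-elim (noPos Eq.refl)
  weight-neg-positive (b ∷ w) _     = reflexive (weight-neg-∷ b w)

  weight-posNeg-positive : ∀ w → posPart w ≢ [] → weight posNeg w ≈ 0#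
  weight-posNeg-positive []      noPos = ⊥-elim (noPos Eq.refl)
  weight-posNeg-positive (b ∷ w) _     = trans (weight-posNeg (b ∷ w)) -0#≈0#

  weight-st : ∀ q {w} → DistinctAbs w → AllNonzero w → weight q (st w) ≡ weight q w
  weight-st q d nz = Eq.cong value (run-signs q (st-signs d nz))

  φ₂-basis-formula : ∀ π → AllNonzero π → φ₂-basis π ≋ (weight start π , st (posPart π)) ∷ []
  φ₂-basis-formula π nz with witnesses π in eq
  ... | (i , j) ∷ _ with witness-sound π nz (Eq.subst ((i , j) ∈_) (Eq.sym eq) (here Eq.refl))
  ...   | inj₁ (Eq.refl , reaches) rewrite reaches = ≋-refl
  ...   | inj₂ (Eq.refl , reaches) rewrite reaches = ≋-refl
  φ₂-basis-formula []      nz | [] = ≋-refl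
  φ₂-basis-formula (a ∷ π) nz | [] = ≋-sym (cons-zero _ (value≈0 (run start (a ∷ π)) Eq.refl))
    where
    value≈0 : ∀ q → run start (a ∷ π) ≡ q → value q ≈ 0#
    value≈0 start  e = ⊥-elim (run-∷≢start start a π e)
    value≈0 neg    _ = refl
    value≈0 pos    e = ⊥-elim (witnesses-complete (a ∷ π) nz (inj₁ e) eq)
    value≈0 posNeg e = ⊥-elim (witnesses-complete (a ∷ π) nz (inj₂ e) eq)
    value≈0 dead   _ = refl

  φ₂-basis-st : ∀ {w} → DistinctAbs w → AllNonzero w → φ₂-basis (st w) ≋ (weight start w , st (posPart w)) ∷ []
  φ₂-basis-st {w} d nz = ≋-trans (φ₂-basis-formula (st w) (st-nonzero d))
    (≡⇒≋ (Eq.cong₂ (λ k P → (k , P) ∷ []) (weight-st start d nz) (st-posPart d nz)))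

  φ₂-unit : φ₂ unit ≋ unit
  φ₂-unit = ≋-trans (linExt-single φ₂-basis 1# [])
                    (≋-trans (scale-cong refl (φ₂-basis-formula [] (λ ())))
                             (cons-cong [] (*-identityʳ 1#) ≋-refl))

  φ₂-counit : ∀ x → IsHSym x → ε (φ₂ x) ≈ ε x
  φ₂-counit x perms = trans (sumWith-linExt isEmpty φ₂-basis x)
    (sumWith-congAll x (All.map (λ π → on-basis _ (signedPerm-nonzero π)) perms))
    where
    -- st of a nonempty word is nonempty, and a nonempty word without positive letters ends in phase neg.
    on-basis : ∀ σ → AllNonzero σ → sumWith isEmpty (φ₂-basis σ) ≈ isEmpty σ
    on-basis σ nz = trans (sumWith-resp isEmpty (φ₂-basis-formula σ nz)) (formula σ (posPart σ) Eq.refl)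
      where
      formula : ∀ σ P → posPart σ ≡ P → weight start σ * isEmpty (st P) + 0# ≈ isEmpty σ
      formula []      _       Eq.refl = trans (+-identityʳ _) (*-identityʳ _)
      formula (a ∷ σ) []      noPos =
        trans (+-identityʳ _) (trans (*-congʳ (reflexive (Eq.cong value (run-negatives a σ _ noPos)))) (zeroˡ _))
      formula (a ∷ σ) (b ∷ P) _     = trans (+-identityʳ _) (zeroʳ _)

module Coproduct {c ℓ} (K : CommutativeRing c ℓ) where

  open Standardisation
  open SignAutomaton
  open import Function using (_∘_; id)
  open import Data.Bool using (Bool; true; false)
  open import Data.Nat using (ℕ; zero; suc)
  open import Data.Integer using (ℤ)
  open import Data.List using (List; []; _∷_; _++_; map; length; take; drop; upTo; applyUpTo)
  import Data.List.Properties as LP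
  open import Data.List.Membership.Propositional using (_∈_)
  open import Data.List.Membership.Propositional.Properties using (∈-map⁻; ∈-++⁺ˡ; ∈-++⁺ʳ)
  open import Data.List.Relation.Unary.Any using (here; there)
  import Data.List.Relation.Unary.All as All
  import Data.List.Relation.Unary.AllPairs.Properties as AllPairsP
  open import Data.Product using (_×_; _,_; proj₁; proj₂)
  import Data.Product.Properties as ×P
  open import Relation.Binary.PropositionalEquality as Eq using (_≡_)

  open CommutativeRing K renaming (Carrier to 𝐤)
  open import Algebra.Properties.Ring ring using (-1*x≈-x)
  open WithRing K using (FS; scale; linExt; bilinExt; basis; φ₂-basis; φ₂; Δ; φ₂⊗φ₂; IsHSym)
  open FormalSums K
  open Phi₂Basis K
  _≟P_ = ×P.≡-dec wordEq? wordEq?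
  open Linear _≟P_

  prependLeft : ℤ → Word × Word → Word × Word
  prependLeft a p = (a ∷ proj₁ p , proj₂ p)

  splits  : Word → List (Word × Word)
  splits₊ : Word → List (Word × Word)
  splits w = ([] , w) ∷ splits₊ w
  splits₊ []      = []
  splits₊ (a ∷ w) = map (prependLeft a) (splits w)

  splits-take-drop : ∀ w → map (λ p → (take p w , drop p w)) (upTo (suc (length w))) ≡ splits w
  splits-take-drop []      = Eq.refl
  splits-take-drop (a ∷ w) = Eq.cong (([] , a ∷ w) ∷_) (begin
    map (λ p → (take p (a ∷ w) , drop p (a ∷ w))) (applyUpTo suc (suc (length w)))
      ≡⟨ map-applyUpTo _ suc (suc (length w)) ⟩
    applyUpTo (λ p → prependLeft a (take p w , drop p w)) (suc (length w))
      ≡⟨ map-applyUpTo (prependLeft a) (λ p → (take p w , drop p w)) (suc (length w)) ⟨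
    map (prependLeft a) (applyUpTo (λ p → (take p w , drop p w)) (suc (length w)))
      ≡⟨ Eq.cong (map (prependLeft a)) (map-applyUpTo _ id (suc (length w))) ⟨
    map (prependLeft a) (map (λ p → (take p w , drop p w)) (upTo (suc (length w))))
      ≡⟨ Eq.cong (map (prependLeft a)) (splits-take-drop w) ⟩
    map (prependLeft a) (splits w) ∎)
    where
    open Eq.≡-Reasoning
    map-applyUpTo : ∀ {A B : Set} (f : A → B) (g : ℕ → A) n → map f (applyUpTo g n) ≡ applyUpTo (f ∘ g) n
    map-applyUpTo f g zero    = Eq.refl
    map-applyUpTo f g (suc n) = Eq.cong (f (g 0) ∷_) (map-applyUpTo f (g ∘ suc) n)

  ∈-splits : ∀ {w s} → s ∈ splits w → proj₁ s ++ proj₂ s ≡ w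
  ∈-splits {w}     (here Eq.refl) = Eq.refl
  ∈-splits {a ∷ w} (there s∈)     with s′ , s′∈ , Eq.refl ← ∈-map⁻ (prependLeft a) s∈ = Eq.cong (a ∷_) (∈-splits s′∈)

  deconcat : Word → FS (Word × Word)
  deconcat = map (1# ,_) ∘ splits

  deconcat₊ : Word → FS (Word × Word)
  deconcat₊ = map (1# ,_) ∘ splits₊

  deconcat₊-∷ : ∀ a v → deconcat₊ (a ∷ v) ≡ mapBasis (prependLeft a) (deconcat v)
  deconcat₊-∷ a v = Eq.trans (Eq.sym (LP.map-∘ (splits v))) (LP.map-∘ (splits v))

  stPair : Word × Word → Word × Word
  stPair p = (st (proj₁ p) , st (proj₂ p))

  Δ-basis : Word → FS (Word × Word)
  Δ-basis σ = map (λ p → (1# , (st (take p σ) , st (drop p σ)))) (upTo (suc (length σ)))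

  Δ-basis-splits : ∀ σ → Δ-basis σ ≡ map (λ s → (1# , stPair s)) (splits σ)
  Δ-basis-splits σ = Eq.trans (LP.map-∘ (upTo (suc (length σ)))) (Eq.cong (map (λ s → (1# , stPair s))) (splits-take-drop σ))

  Δ-basis-st : ∀ {P} → DistinctAbs P → Δ-basis (st P) ≡ mapBasis stPair (deconcat P)
  Δ-basis-st {P} d = begin
    Δ-basis (st P)
      ≡⟨ LP.map-cong (λ p → Eq.cong₂ (λ x y → (1# , (x , y))) (st-take d p) (st-drop d p)) (upTo (suc (length (st P)))) ⟩
    map (λ p → (1# , stPair (take p P , drop p P))) (upTo (suc (length (st P))))
      ≡⟨ Eq.cong (λ n → map (λ p → (1# , stPair (take p P , drop p P))) (upTo (suc n))) (st-length d) ⟩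
    Δ-basis P
      ≡⟨ Δ-basis-splits P ⟩
    map (λ s → (1# , stPair s)) (splits P)
      ≡⟨ LP.map-∘ (splits P) ⟩
    mapBasis stPair (deconcat P) ∎
    where open Eq.≡-Reasoning

  prependLeftIf : Bool → ℤ → Word × Word → Word × Word
  prependLeftIf s a p = (prependIf s a (proj₁ p) , proj₂ p)

  -- φ₂ ⊗ φ₂ (Δ w) is splitWeights start w up to standardising both factors; the other phases
  -- are the generalisation needed for the induction on w.
  splitWeights : Phase → Word → FS (Word × Word)
  splitWeights q w =
    map (λ p → (weight q (proj₁ p) * weight start (proj₂ p) , (posPart (proj₁ p) , posPart (proj₂ p)))) (splits w)

  splitWeights-∷ : ∀ q a w → splitWeights q (a ∷ w) ≡
    (value q * weight start (a ∷ w) , ([] , prependIf (isPos a) a (posPart w)))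
      ∷ mapBasis (prependLeftIf (isPos a) a) (splitWeights (step q (isPos a)) w)
  splitWeights-∷ q a w = Eq.cong₂ _∷_
    (Eq.cong (λ P → (value q * weight start (a ∷ w) , ([] , P))) (posPart-∷ a w))
    (Eq.trans (Eq.sym (LP.map-∘ (splits w)))
      (Eq.trans (LP.map-cong (λ p → Eq.cong (λ P → (weight q (a ∷ proj₁ p) * weight start (proj₂ p) , (P , posPart (proj₂ p))))
                                         (posPart-∷ a (proj₁ p))) (splits w))
                (LP.map-∘ (splits w))))

  closedForm : Phase → Word → FS (Word × Word)
  closedForm start  w = scale (weight start w) (deconcat (posPart w))
  closedForm neg    w = scale (weight neg w) (deconcat₊ (posPart w))
  closedForm pos    w = scale (weight pos w) (deconcat (posPart w))
  closedForm posNeg w = (- weight start w , ([] , posPart w)) ∷ []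
  closedForm dead   w = []

  private
    closedForm-after : Phase → Bool → ℤ → Word → FS (Word × Word)
    closedForm-after start  s a w = scale (weight (step start s) w) (deconcat (prependIf s a (posPart w)))
    closedForm-after neg    s a w = scale (weight (step neg s) w) (deconcat₊ (prependIf s a (posPart w)))
    closedForm-after pos    s a w = scale (weight (step pos s) w) (deconcat (prependIf s a (posPart w)))
    closedForm-after posNeg s a w = (- weight (step start s) w , ([] , prependIf s a (posPart w))) ∷ []
    closedForm-after dead   s a w = []

    closedForm-∷ : ∀ q a w → closedForm q (a ∷ w) ≡ closedForm-after q (isPos a) a w
    closedForm-∷ start  a w = Eq.cong (λ P → scale (weight start (a ∷ w)) (deconcat P)) (posPart-∷ a w)
    closedForm-∷ neg    a w = Eq.cong (λ P → scale (weight neg (a ∷ w)) (deconcat₊ P)) (posPart-∷ a w)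
    closedForm-∷ pos    a w = Eq.cong (λ P → scale (weight pos (a ∷ w)) (deconcat P)) (posPart-∷ a w)
    closedForm-∷ posNeg a w = Eq.cong (λ P → (- weight start (a ∷ w) , ([] , P)) ∷ []) (posPart-∷ a w)
    closedForm-∷ dead   a w = Eq.refl

    mapBasis-prependLeftIf-false : ∀ a x → mapBasis (prependLeftIf false a) x ≡ x
    mapBasis-prependLeftIf-false a = LP.map-id

    prepend-deconcat : ∀ k a P {x} → x ≋ scale k (deconcat P) → mapBasis (prependLeft a) x ≋ scale k (deconcat₊ (a ∷ P))
    prepend-deconcat k a P x≋ = ≋-trans (mapBasis-resp _≟P_ (prependLeft a) x≋)
      (≡⇒≋ (Eq.sym (Eq.trans (Eq.cong (scale k) (deconcat₊-∷ a P)) (scale-mapBasis k (prependLeft a) (deconcat P)))))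

    splitWeights-step : ∀ q s a w → splitWeights (step q s) w ≋ closedForm (step q s) w →
      (value q * weight (step start s) w , ([] , prependIf s a (posPart w))) ∷ mapBasis (prependLeftIf s a) (splitWeights (step q s) w)
        ≋ closedForm-after q s a w
    splitWeights-step start  true  a w ih = cons-cong _ (*-comm _ _) (prepend-deconcat _ a (posPart w) ih)
    splitWeights-step neg    true  a w ih = ≋-trans (cons-zero _ (zeroˡ _)) (prepend-deconcat _ a (posPart w) ih)
    splitWeights-step pos    true  a w ih = cons-cong _ (*-comm _ _) (prepend-deconcat _ a (posPart w) ih)
    splitWeights-step posNeg true  a w ih = cons-cong _ (-1*x≈-x _) (mapBasis-resp _≟P_ (prependLeft a) ih)
    splitWeights-step dead   true  a w ih = ≋-trans (cons-zero _ (zeroˡ _)) (mapBasis-resp _≟P_ (prependLeft a) ih)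
    splitWeights-step start  false a w ih =
      cons-cong _ (*-comm _ _) (≋-trans (≡⇒≋ (mapBasis-prependLeftIf-false a _)) ih)
    splitWeights-step neg    false a w ih = ≋-trans (cons-zero _ (zeroˡ _)) (≋-trans (≡⇒≋ (mapBasis-prependLeftIf-false a _)) ih)
    splitWeights-step pos    false a w ih =
      ≋-trans (cons-cong _ refl (≋-trans (≡⇒≋ (mapBasis-prependLeftIf-false a _)) ih)) (lastNegative w)
      where
      lastNegative : ∀ w → (1# * weight neg w , ([] , posPart w)) ∷ (- weight start w , ([] , posPart w)) ∷ []
                             ≋ scale (weight posNeg w) (deconcat (posPart w))
      lastNegative []      = ≋-trans (cons-zero _ (zeroʳ _)) (cons-cong _ (sym (*-identityʳ _)) ≋-refl)
      lastNegative (b ∷ w) = ≋-trans (cons-merge _ _ _ [])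
        (≋-trans (cons-zero _ (trans (+-congʳ (trans (*-identityˡ _) (reflexive (weight-neg-∷ b w)))) (-‿inverseʳ _)))
                 (≋-sym (scale-zero _ (weight-dead w))))
    splitWeights-step posNeg false a w ih = cons-cong _ (-1*x≈-x _) (≋-trans (≡⇒≋ (mapBasis-prependLeftIf-false a _)) ih)
    splitWeights-step dead   false a w ih = ≋-trans (cons-zero _ (zeroˡ _)) (≋-trans (≡⇒≋ (mapBasis-prependLeftIf-false a _)) ih)

  splitWeights≋closedForm : ∀ q w → splitWeights q w ≋ closedForm q w
  splitWeights≋closedForm start  [] = ≋-refl
  splitWeights≋closedForm neg    [] = cons-zero _ (zeroˡ _)
  splitWeights≋closedForm pos    [] = ≋-refl
  splitWeights≋closedForm posNeg [] = cons-cong _ (*-identityʳ _) ≋-refl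
  splitWeights≋closedForm dead   [] = cons-zero _ (zeroˡ _)
  splitWeights≋closedForm q (a ∷ w) =
    ≋-trans (≡⇒≋ (splitWeights-∷ q a w))
      (≋-trans (splitWeights-step q (isPos a) a w (splitWeights≋closedForm (step q (isPos a)) w))
               (≡⇒≋ (Eq.sym (closedForm-∷ q a w))))

  tensor : Word × Word → FS (Word × Word)
  tensor p = bilinExt (λ u v → basis (u , v)) (φ₂-basis (proj₁ p)) (φ₂-basis (proj₂ p))

  tensor-stPair : ∀ {u v} → DistinctAbs (u ++ v) → AllNonzero (u ++ v) →
    tensor (stPair (u , v)) ≋ (weight start u * weight start v , (st (posPart u) , st (posPart v))) ∷ []
  tensor-stPair {u} {v} d nz = ≋-trans
    (bilinExt-resp wordEq? wordEq? (λ u v → basis (u , v)) (φ₂-basis-st du (nz ∘ ∈-++⁺ˡ)) (φ₂-basis-st dv (nz ∘ ∈-++⁺ʳ u)))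
    (cons-cong _ (*-identityʳ _) ≋-refl)
    where
    du = distinctAbs-++⁻ˡ u d
    dv = distinctAbs-++⁻ʳ u d

  Δ-φ₂-basis : ∀ σ → IsSignedPerm σ → linExt Δ-basis (φ₂-basis σ) ≋ linExt tensor (Δ-basis σ)
  Δ-φ₂-basis σ π = begin
    linExt Δ-basis (φ₂-basis σ)
      ≈⟨ linExt-resp wordEq? Δ-basis (φ₂-basis-formula σ nz) ⟩
    linExt Δ-basis ((weight start σ , st (posPart σ)) ∷ [])
      ≈⟨ linExt-single Δ-basis (weight start σ) (st (posPart σ)) ⟩
    scale (weight start σ) (Δ-basis (st (posPart σ)))
      ≡⟨ Eq.cong (scale (weight start σ)) (Δ-basis-st (AllPairsP.filter⁺ _ d)) ⟩
    scale (weight start σ) (mapBasis stPair (deconcat (posPart σ)))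
      ≡⟨ scale-mapBasis (weight start σ) stPair (deconcat (posPart σ)) ⟩
    mapBasis stPair (closedForm start σ)
      ≈⟨ mapBasis-resp _≟P_ stPair (splitWeights≋closedForm start σ) ⟨
    mapBasis stPair (splitWeights start σ)
      ≡⟨ LP.map-∘ (splits σ) ⟨
    map (λ s → (weight start (proj₁ s) * weight start (proj₂ s) , stPair (posPart (proj₁ s) , posPart (proj₂ s)))) (splits σ)
      ≈⟨ linExt-units (splits σ) (λ {s} s∈ → tensor-stPair {proj₁ s} {proj₂ s} (Eq.subst DistinctAbs (Eq.sym (∈-splits s∈)) d)
                                                         (Eq.subst AllNonzero (Eq.sym (∈-splits s∈)) nz)) ⟨
    linExt tensor (map (λ s → (1# , stPair s)) (splits σ))
      ≡⟨ Eq.cong (linExt tensor) (Δ-basis-splits σ) ⟨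
    linExt tensor (Δ-basis σ) ∎
    where
    open ≋-Reasoning
    d  = signedPerm-distinct π
    nz = signedPerm-nonzero π
    linExt-units : ∀ {H : Word × Word → 𝐤 × (Word × Word)} L → (∀ {s} → s ∈ L → tensor (stPair s) ≋ H s ∷ []) →
                   linExt tensor (map (λ s → (1# , stPair s)) L) ≋ map H L
    linExt-units []      _      = ≋-refl
    linExt-units (s ∷ L) tensor≋ = ++-cong (≋-trans (scale-1 _) (tensor≋ (here Eq.refl))) (linExt-units L (tensor≋ ∘ there))

  φ₂-comultiplicative : ∀ x → IsHSym x → Δ (φ₂ x) ≋ φ₂⊗φ₂ (Δ x)
  φ₂-comultiplicative x perms = begin
    linExt Δ-basis (linExt φ₂-basis x)        ≈⟨ linExt-∘ Δ-basis φ₂-basis x ⟩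
    linExt (linExt Δ-basis ∘ φ₂-basis) x     ≈⟨ linExt-cong x (All.map (Δ-φ₂-basis _) perms) ⟩
    linExt (linExt tensor ∘ Δ-basis) x       ≈⟨ linExt-∘ tensor Δ-basis x ⟨
    linExt tensor (linExt Δ-basis x)          ∎
    where open ≋-Reasoning

module Product {c ℓ} (K : CommutativeRing c ℓ) where

  open Standardisation
  open SignAutomaton
  open import Function using (_∘_)
  open import Data.Bool using (Bool; true; false; _∧_; not; if_then_else_)
  open import Data.Nat using (suc; _≤_)
  open import Data.Integer using (ℤ; +_; -[1+_]; ∣_∣)
  open import Data.List using ([]; _∷_; _++_; map; length)
  import Data.List.Properties as LP
  open import Data.List.Membership.Propositional using (_∈_)
  open import Data.List.Membership.Propositional.Properties using (∈-++⁺ˡ; ∈-++⁺ʳ; ∈-++⁻)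
  open import Data.List.Relation.Binary.Subset.Propositional using (_⊆_)
  open import Data.List.Relation.Unary.Any using (here; there)
  open import Data.List.Relation.Unary.All as All using (All; []; _∷_)
  import Data.List.Relation.Unary.All.Properties as AllP
  open import Data.List.Relation.Unary.AllPairs as AllPairs using (_∷_)
  import Data.List.Relation.Unary.AllPairs.Properties as AllPairsP
  open import Data.List.Relation.Binary.Permutation.Propositional using (_↭_; ↭-refl; ↭-sym; ↭-trans; prep)
  import Data.List.Relation.Binary.Permutation.Propositional.Properties as ↭P
  open import Data.Product using (_×_; _,_; proj₁; proj₂)
  open import Data.Sum using (inj₁; inj₂)
  open import Relation.Binary.PropositionalEquality as Eq using (_≡_; _≢_)

  open CommutativeRing K renaming (Carrier to 𝐤)
  open import Algebra.Properties.Ring ring using (-1*x≈-x; -‿distribˡ-*; -‿distribʳ-*; -0#≈0#; -‿involutive; -‿+-comm)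
  open import Algebra.Properties.CommutativeSemigroup +-commutativeSemigroup using () renaming (interchange to +-interchange)
  open WithRing K using (FS; scale; linExt; bilinExt; basis; star; shuffle; prefix; φ₂-basis; φ₂; _⋆H_; _⧢S_; IsHSym)
  open FormalSums K
  open Phi₂Basis K
  open Linear wordEq?

  shuffle-↭ : ∀ u v → All (λ t → proj₂ t ↭ u ++ v) (shuffle u v)
  shuffle-↭ []      v       = ↭-refl ∷ []
  shuffle-↭ (a ∷ u) []      = ↭-sym (↭P.++-identityʳ (a ∷ u)) ∷ []
  shuffle-↭ (a ∷ u) (b ∷ v) = AllP.++⁺
    (AllP.map⁺ (All.map (prep a) (shuffle-↭ u (b ∷ v))))
    (AllP.map⁺ (All.map (λ t↭ → ↭-trans (prep b t↭) (↭-sym (↭P.shift b (a ∷ u) v))) (shuffle-↭ (a ∷ u) v)))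

  Within : Word → Word → Set
  Within w t = t ⊆ w × DistinctAbs t

  star-within : ∀ u v → DistinctAbs (u ++ v) → All (λ t → Within (u ++ v) (proj₂ t)) (star u v)
  star-within []      v       d = ((λ x∈ → x∈) , d) ∷ []
  star-within (a ∷ u) []      d =
    ((λ {x} x∈ → Eq.subst (x ∈_) (Eq.sym (LP.++-identityʳ (a ∷ u))) x∈) , distinctAbs-++⁻ˡ (a ∷ u) d) ∷ []
  star-within (a ∷ u) (b ∷ v) d@(a≉ ∷ d-tail) = AllP.++⁺
    (AllP.map⁺ (All.map (cons-a (λ x∈ → x∈)) (star-within u (b ∷ v) d-tail)))
    (AllP.++⁺
      (AllP.map⁺ (All.map cons-b (star-within (a ∷ u) v (AllPairs.tail b-first))))
      merged)
    where
    b-first : DistinctAbs (b ∷ (a ∷ u) ++ v)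
    b-first = distinctAbs-↭ (↭P.shift b (a ∷ u) v) d
    insert-b : ∀ {x} → x ∈ u ++ v → x ∈ u ++ b ∷ v
    insert-b x∈ with ∈-++⁻ u x∈
    ... | inj₁ x∈u = ∈-++⁺ˡ x∈u
    ... | inj₂ x∈v = ∈-++⁺ʳ u (there x∈v)
    cons-a : ∀ {w t} → (∀ {x} → x ∈ w → x ∈ u ++ b ∷ v) → Within w t → Within ((a ∷ u) ++ b ∷ v) (a ∷ t)
    cons-a w⊆ (t⊆ , dt) = (λ { (here Eq.refl) → here Eq.refl ; (there x∈) → there (w⊆ (t⊆ x∈)) })
                          , All.tabulate (λ x∈ → All.lookup a≉ (w⊆ (t⊆ x∈))) ∷ dt
    cons-b : ∀ {t} → Within ((a ∷ u) ++ v) t → Within ((a ∷ u) ++ b ∷ v) (b ∷ t)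
    cons-b (t⊆ , dt) with b≉ ∷ _ ← b-first =
      (λ { (here Eq.refl) → ∈-++⁺ʳ (a ∷ u) (here Eq.refl)
         ; (there x∈) → ↭P.∈-resp-↭ (↭-sym (↭P.shift b (a ∷ u) v)) (there (t⊆ x∈)) })
      , All.tabulate (λ x∈ → All.lookup b≉ (t⊆ x∈)) ∷ dt
    merged : All (λ t → Within ((a ∷ u) ++ b ∷ v) (proj₂ t))
                 (if isNeg a ∧ isNeg b then scale (- 1#) (prefix a (star u v)) else [])
    merged with isNeg a ∧ isNeg b
    ... | true  = AllP.map⁺ (AllP.map⁺ (All.map (cons-a insert-b)
                    (star-within u v (AllPairs.tail (AllPairs.tail b-first)))))
    ... | false = []

  mapBasis-shuffle : ∀ (f : ℤ → ℤ) u v → mapBasis (map f) (shuffle u v) ≡ shuffle (map f u) (map f v)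
  mapBasis-shuffle f []      v       = Eq.refl
  mapBasis-shuffle f (a ∷ u) []      = Eq.refl
  mapBasis-shuffle f (a ∷ u) (b ∷ v) =
    Eq.trans (LP.map-++ _ (prefix a (shuffle u (b ∷ v))) (prefix b (shuffle (a ∷ u) v)))
      (Eq.cong₂ _++_ (prefix-map a (shuffle u (b ∷ v)) (mapBasis-shuffle f u (b ∷ v)))
                     (prefix-map b (shuffle (a ∷ u) v) (mapBasis-shuffle f (a ∷ u) v)))
    where
    prefix-map : ∀ c X {Y} → mapBasis (map f) X ≡ Y → mapBasis (map f) (prefix c X) ≡ prefix (f c) Y
    prefix-map c X Eq.refl = Eq.trans (Eq.sym (LP.map-∘ X)) (LP.map-∘ X)

  st-shuffle : ∀ m {u v} → (∀ {x} → x ∈ u → ∣ x ∣ ≤ m) → AllNonzero v → DistinctAbs u → DistinctAbs v →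
               mapBasis st (shuffle u (shift m v)) ≡ shuffle (st u) (shift (length (st u)) (st v))
  st-shuffle m {u} {v} u≤m nzv du dv = begin
    mapBasis st (shuffle u (shift m v))
      ≡⟨ LP.map-cong-local (All.map (λ t↭ → Eq.cong (_ ,_) (st-↭ t↭ (distinctAbs-++-shift m u≤m nzv du dv))) (shuffle-↭ u _)) ⟩
    mapBasis (map G) (shuffle u (shift m v))
      ≡⟨ mapBasis-shuffle G u (shift m v) ⟩
    shuffle (map G u) (map G (map (shiftL m) v))
      ≡⟨ Eq.cong₂ shuffle (LP.map-cong-local (All.tabulate (relabel-++-shiftˡ m u≤m nzv)))
                          (Eq.trans (Eq.sym (LP.map-∘ v)) (LP.map-cong-local (All.tabulate (relabel-++-shiftʳ m u≤m nzv)))) ⟩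
    shuffle (map (relabel u) u) (map (shiftL (length u) ∘ relabel v) v)
      ≡⟨ Eq.cong₂ shuffle (st-distinct u du) (Eq.trans (Eq.cong₂ shift (st-length du) (st-distinct v dv)) (Eq.sym (LP.map-∘ v))) ⟨
    shuffle (st u) (shift (length (st u)) (st v)) ∎
    where
    open Eq.≡-Reasoning
    G = relabel (u ++ shift m v)

  weighted : Phase → FS Word → FS Word
  weighted q = map (λ t → (proj₁ t * weight q (proj₂ t) , posPart (proj₂ t)))

  weighted-++ : ∀ q x y → weighted q (x ++ y) ≡ weighted q x ++ weighted q y
  weighted-++ q = LP.map-++ _

  weighted-prefix : ∀ q a x → weighted q (prefix a x) ≡ mapBasis (prependIf (isPos a) a) (weighted (step q (isPos a)) x)
  weighted-prefix q a x = Eq.trans (Eq.sym (LP.map-∘ x))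
    (Eq.trans (LP.map-cong (λ t → Eq.cong (λ P → (proj₁ t * weight q (a ∷ proj₂ t) , P)) (posPart-∷ a (proj₂ t))) x) (LP.map-∘ x))

  weighted-scale : ∀ q k x → weighted q (scale k x) ≋ scale k (weighted q x)
  weighted-scale q k []      = ≋-refl
  weighted-scale q k (t ∷ x) = cons-cong _ (*-assoc _ _ _) (weighted-scale q k x)

  -- Stated in terms of profiles only, so that peeling a letter off u or v (profile-∷) is definitional.
  starWeight-of : Phase → (Phase → 𝐤) → 𝐤 → (Phase → 𝐤) → 𝐤 → 𝐤
  starWeight-of start  U eU V eV = U start * V start
  starWeight-of neg    U eU V eV = U start * V start + - (eU * eV)
  starWeight-of pos    U eU V eV = U pos * V pos
  starWeight-of posNeg U eU V eV = - (eU * eV)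
  starWeight-of dead   U eU V eV = 0#

  profile : Word → Phase → 𝐤
  profile w q = weight q w

  profile-∷ : Bool → Word → Phase → 𝐤
  profile-∷ s w q = weight (step q s) w

  -- starWeight q u v is the coefficient of ū ⧢ v̄ in weighted q (star u v); the phases neg and posNeg
  -- differ from start and dead only on the empty word, whence the correction terms − [u = v = ∅].
  starWeight : Phase → Word → Word → 𝐤
  starWeight q u v = starWeight-of q (profile u) (isEmpty u) (profile v) (isEmpty v)

  private
    prepend-resp : ∀ a {x y} → x ≋ y → mapBasis (a ∷_) x ≋ mapBasis (a ∷_) y
    prepend-resp a = mapBasis-resp wordEq? (a ∷_)

    shuffle-[] : ∀ w → shuffle w [] ≡ basis w
    shuffle-[] []      = Eq.refl
    shuffle-[] (a ∷ w) = Eq.refl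

    scale-shuffle-∷∷ : ∀ k a b Pu Pv →
      scale k (shuffle (a ∷ Pu) (b ∷ Pv))
        ≡ mapBasis (a ∷_) (scale k (shuffle Pu (b ∷ Pv))) ++ mapBasis (b ∷_) (scale k (shuffle (a ∷ Pu) Pv))
    scale-shuffle-∷∷ k a b Pu Pv = Eq.trans (scale-++ k (prefix a (shuffle Pu (b ∷ Pv))) (prefix b (shuffle (a ∷ Pu) Pv)))
      (Eq.cong₂ _++_ (scale-mapBasis k (a ∷_) (shuffle Pu (b ∷ Pv))) (scale-mapBasis k (b ∷_) (shuffle (a ∷ Pu) Pv)))

    both-positive : ∀ a b Pu Pv {α₁ α₂ α} {x₁ x₂} → α₁ ≈ α → α₂ ≈ α →
      x₁ ≋ scale α₁ (shuffle Pu (b ∷ Pv)) → x₂ ≋ scale α₂ (shuffle (a ∷ Pu) Pv) →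
      mapBasis (a ∷_) x₁ ++ mapBasis (b ∷_) x₂ ++ [] ≋ scale α (shuffle (a ∷ Pu) (b ∷ Pv))
    both-positive a b Pu Pv α₁≈α α₂≈α x₁≋ x₂≋ = ≋-trans
      (++-cong (prepend-resp a (≋-trans x₁≋ (scale-cong α₁≈α ≋-refl)))
               (≋-trans (++-[] _) (prepend-resp b (≋-trans x₂≋ (scale-cong α₂≈α ≋-refl)))))
      (≡⇒≋ (Eq.sym (scale-shuffle-∷∷ _ a b Pu Pv)))

    positive-negative : ∀ a Pu Pv {α₁ α₂ α} {x₁ x₂} →
      (Pv ≡ [] → α₁ + α₂ ≈ α) → (Pv ≢ [] → α₁ ≈ 0# × α₂ ≈ α) →
      x₁ ≋ scale α₁ (shuffle Pu Pv) → x₂ ≋ scale α₂ (shuffle (a ∷ Pu) Pv) →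
      mapBasis (a ∷_) x₁ ++ x₂ ++ [] ≋ scale α (shuffle (a ∷ Pu) Pv)
    positive-negative a Pu [] {α₁} empty _ x₁≋ x₂≋ = ≋-trans
      (++-cong (prepend-resp a (≋-trans x₁≋ (≡⇒≋ (Eq.cong (scale α₁) (shuffle-[] Pu))))) (≋-trans (++-[] _) x₂≋))
      (≋-trans (cons-merge _ _ _ []) (cons-cong _ (trans (sym (distribʳ 1# _ _)) (*-congʳ (empty Eq.refl))) ≋-refl))
    positive-negative a Pu (c ∷ Pv) _ nonempty x₁≋ x₂≋ = let α₁≈0 , α₂≈α = nonempty (λ ()) in ≋-trans
      (++-cong (prepend-resp a (≋-trans x₁≋ (scale-zero _ α₁≈0))) (≋-trans (++-[] _) x₂≋))
      (scale-cong α₂≈α ≋-refl)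

    negative-positive : ∀ b Pu Pv {α₁ α₂ α} {x₁ x₂} →
      (Pu ≡ [] → α₁ + α₂ ≈ α) → (Pu ≢ [] → α₁ ≈ α × α₂ ≈ 0#) →
      x₁ ≋ scale α₁ (shuffle Pu (b ∷ Pv)) → x₂ ≋ scale α₂ (shuffle Pu Pv) →
      x₁ ++ mapBasis (b ∷_) x₂ ++ [] ≋ scale α (shuffle Pu (b ∷ Pv))
    negative-positive b [] Pv empty _ x₁≋ x₂≋ = ≋-trans
      (++-cong x₁≋ (≋-trans (++-[] _) (prepend-resp b x₂≋)))
      (≋-trans (cons-merge _ _ _ []) (cons-cong _ (trans (sym (distribʳ 1# _ _)) (*-congʳ (empty Eq.refl))) ≋-refl))
    negative-positive b (c ∷ Pu) Pv _ nonempty x₁≋ x₂≋ = let α₁≈α , α₂≈0 = nonempty (λ ()) in ≋-trans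
      (++-cong (≋-trans x₁≋ (scale-cong α₁≈α ≋-refl))
               (≋-trans (++-[] _) (prepend-resp b (≋-trans x₂≋ (scale-zero _ α₂≈0)))))
      (++-[] _)

    both-negative : ∀ y {α₁ α₂ α₃ α} {x₁ x₂ x₃} → α₁ + (α₂ + - 1# * α₃) ≈ α →
      x₁ ≋ scale α₁ y → x₂ ≋ scale α₂ y → x₃ ≋ scale α₃ y → x₁ ++ x₂ ++ scale (- 1#) x₃ ≋ scale α y
    both-negative y {α₁} {α₂} {α₃} sum≈α x₁≋ x₂≋ x₃≋ = ≋-trans
      (++-cong x₁≋ (++-cong x₂≋ (≋-trans (scale-cong refl x₃≋) (scale-scale (- 1#) α₃ y))))
      (≋-trans (++-cong ≋-refl (scale-+ α₂ (- 1# * α₃) y)) (≋-trans (scale-+ α₁ _ y) (scale-cong sum≈α ≋-refl)))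

  private
    -0*≈0 : ∀ y → - (0# * y) ≈ 0#
    -0*≈0 y = trans (-‿cong (zeroˡ y)) -0#≈0#

    -*0≈0 : ∀ y → - (y * 0#) ≈ 0#
    -*0≈0 y = trans (-‿cong (zeroʳ y)) -0#≈0#

    +≈0ʳ : ∀ x {z} → z ≈ 0# → x + z ≈ x
    +≈0ʳ x z≈0 = trans (+-congˡ z≈0) (+-identityʳ x)

    +≈0ˡ : ∀ x {z} → z ≈ 0# → z + x ≈ x
    +≈0ˡ x z≈0 = trans (+-congʳ z≈0) (+-identityˡ x)

    -x*-y≈x*y : ∀ x y → - x * - y ≈ x * y
    -x*-y≈x*y x y = trans (sym (-‿distribˡ-* x (- y))) (trans (-‿cong (sym (-‿distribʳ-* x y))) (-‿involutive _))

    both-negative-identity : ∀ x y e f → x * (y + - f) + ((x + - e) * y + - 1# * (x * y + - (e * f))) ≈ (x + - e) * (y + - f)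
    both-negative-identity x y e f = begin
      x * (y + - f) + ((x + - e) * y + - 1# * (x * y + - (e * f)))
        ≈⟨ +-congˡ (+-congʳ (trans (distribʳ y x (- e)) (+-congˡ (sym (-‿distribˡ-* e y))))) ⟩
      x * (y + - f) + ((x * y + - (e * y)) + - 1# * (x * y + - (e * f)))
        ≈⟨ +-congˡ (+-congˡ (trans (-1*x≈-x _) (trans (sym (-‿+-comm _ _)) (+-congˡ (-‿involutive _))))) ⟩
      x * (y + - f) + ((x * y + - (e * y)) + (- (x * y) + e * f))
        ≈⟨ +-congˡ (+-interchange _ _ _ _) ⟩
      x * (y + - f) + ((x * y + - (x * y)) + (- (e * y) + e * f))
        ≈⟨ +-congˡ (+≈0ˡ _ (-‿inverseʳ _)) ⟩
      x * (y + - f) + (- (e * y) + e * f)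
        ≈⟨ +-congˡ (trans (+-congˡ (sym (-‿involutive _))) (-‿+-comm _ _)) ⟩
      x * (y + - f) + - (e * y + - (e * f))
        ≈⟨ +-congˡ (-‿cong (trans (+-congˡ (-‿distribʳ-* e f)) (sym (distribˡ e y (- f))))) ⟩
      x * (y + - f) + - (e * (y + - f))
        ≈⟨ +-congˡ (-‿distribˡ-* e _) ⟩
      x * (y + - f) + - e * (y + - f)
        ≈⟨ distribʳ _ x (- e) ⟨
      (x + - e) * (y + - f) ∎
      where open import Relation.Binary.Reasoning.Setoid setoid

  module _ (u v : Word) where

    private
      α : Phase → 𝐤
      α q = starWeight q u v
      αʳ : Phase → Bool → 𝐤
      αʳ q s = starWeight-of q (profile u) (isEmpty u) (profile-∷ s v) 0#
      αˡ : Phase → Bool → 𝐤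
      αˡ q s = starWeight-of q (profile-∷ s u) 0# (profile v) (isEmpty v)
      αˡʳ : Phase → Bool → Bool → 𝐤
      αˡʳ q s s′ = starWeight-of q (profile-∷ s u) 0# (profile-∷ s′ v) 0#

    starWeight-⁺⁺ : ∀ q → αʳ (step q true) true ≈ αˡʳ q true true × αˡ (step q true) true ≈ αˡʳ q true true
    starWeight-⁺⁺ start  = refl , refl
    starWeight-⁺⁺ neg    = sym (+≈0ʳ _ (-0*≈0 0#)) , sym (+≈0ʳ _ (-0*≈0 0#))
    starWeight-⁺⁺ pos    = refl , refl
    starWeight-⁺⁺ posNeg = sym (-0*≈0 0#) , sym (-0*≈0 0#)
    starWeight-⁺⁺ dead   = refl , refl

    starWeight-⁺⁻ : ∀ q → (posPart v ≡ [] → αʳ (step q true) false + αˡ (step q false) true ≈ αˡʳ q true false)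
                        × (posPart v ≢ [] → αʳ (step q true) false ≈ 0# × αˡ (step q false) true ≈ αˡʳ q true false)
    starWeight-⁺⁻ start  = (λ _ → sum) , (λ v⁺ → trans (*-congˡ (weight-posNeg-positive v v⁺)) (zeroʳ _)
                                              , trans (+≈0ʳ _ (-0*≈0 _)) (*-congˡ (sym (weight-neg-positive v v⁺))))
      where
      sum : weight pos u * weight posNeg v + (weight pos u * weight start v + - (0# * isEmpty v)) ≈ weight pos u * weight neg v
      sum = trans (+-congˡ (+≈0ʳ _ (-0*≈0 _))) (trans (sym (distribˡ _ _ _))
              (*-congˡ (trans (+-comm _ _) (trans (+-congˡ (weight-posNeg v)) (sym (weight-neg v))))))
    starWeight-⁺⁻ neg    = (λ v⁺ → trans (proj₁ (starWeight-⁺⁻ start) v⁺) (sym (+≈0ʳ _ (-0*≈0 0#))))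
                         , (λ v⁺ → let α₁≈0 , α₂≈α = proj₂ (starWeight-⁺⁻ start) v⁺
                                   in α₁≈0 , trans α₂≈α (sym (+≈0ʳ _ (-0*≈0 0#))))
    starWeight-⁺⁻ pos    = (λ _ → +≈0ʳ _ (-0*≈0 _))
                         , (λ v⁺ → trans (*-congˡ (weight-posNeg-positive v v⁺)) (zeroʳ _)
                                 , trans (-0*≈0 _) (sym (trans (*-congˡ (weight-posNeg-positive v v⁺)) (zeroʳ _))))
    starWeight-⁺⁻ posNeg = (λ _ → trans (+-identityʳ 0#) (sym (-0*≈0 0#))) , (λ _ → refl , sym (-0*≈0 0#))
    starWeight-⁺⁻ dead   = (λ _ → +-identityʳ 0#) , (λ _ → refl , refl)

    starWeight-⁻⁺ : ∀ q → (posPart u ≡ [] → αʳ (step q false) true + αˡ (step q true) false ≈ αˡʳ q false true)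
                        × (posPart u ≢ [] → αʳ (step q false) true ≈ αˡʳ q false true × αˡ (step q true) false ≈ 0#)
    starWeight-⁻⁺ start  = (λ _ → sum) , (λ u⁺ → trans (+≈0ʳ _ (-*0≈0 _)) (*-congʳ (sym (weight-neg-positive u u⁺)))
                                              , trans (*-congʳ (weight-posNeg-positive u u⁺)) (zeroˡ _))
      where
      sum : (weight start u * weight pos v + - (isEmpty u * 0#)) + weight posNeg u * weight pos v ≈ weight neg u * weight pos v
      sum = trans (+-congʳ (+≈0ʳ _ (-*0≈0 _))) (trans (sym (distribʳ _ _ _))
              (*-congʳ (trans (+-congˡ (weight-posNeg u)) (sym (weight-neg u)))))
    starWeight-⁻⁺ neg    = (λ u⁺ → trans (proj₁ (starWeight-⁻⁺ start) u⁺) (sym (+≈0ʳ _ (-0*≈0 0#))))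
                         , (λ u⁺ → let α₁≈α , α₂≈0 = proj₂ (starWeight-⁻⁺ start) u⁺
                                   in trans α₁≈α (sym (+≈0ʳ _ (-0*≈0 0#))) , α₂≈0)
    starWeight-⁻⁺ pos    = (λ _ → +≈0ˡ _ (-*0≈0 _))
                         , (λ u⁺ → trans (-*0≈0 _) (sym (trans (*-congʳ (weight-posNeg-positive u u⁺)) (zeroˡ _)))
                                 , trans (*-congʳ (weight-posNeg-positive u u⁺)) (zeroˡ _))
    starWeight-⁻⁺ posNeg = (λ _ → trans (+-identityʳ 0#) (sym (-0*≈0 0#))) , (λ _ → sym (-0*≈0 0#) , refl)
    starWeight-⁻⁺ dead   = (λ _ → +-identityʳ 0#) , (λ _ → refl , refl)

    starWeight-⁻⁻ : ∀ q → αʳ (step q false) false + (αˡ (step q false) false + - 1# * α (step q false)) ≈ αˡʳ q false false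
    starWeight-⁻⁻ start  = trans
      (+-cong (trans (+≈0ʳ _ (-*0≈0 _)) (*-congˡ (weight-neg v))) (+-congʳ (trans (+≈0ʳ _ (-0*≈0 _)) (*-congʳ (weight-neg u)))))
      (trans (both-negative-identity _ _ _ _) (sym (*-cong (weight-neg u) (weight-neg v))))
    starWeight-⁻⁻ neg    = trans (starWeight-⁻⁻ start) (sym (+≈0ʳ _ (-0*≈0 0#)))
    starWeight-⁻⁻ pos    = trans (+≈0ˡ _ (-*0≈0 _)) (trans (+≈0ˡ _ (-0*≈0 _)) (trans (-1*x≈-x _) (trans (-‿involutive _)
                             (sym (trans (*-cong (weight-posNeg u) (weight-posNeg v)) (-x*-y≈x*y _ _))))))
    starWeight-⁻⁻ posNeg = trans zero-sum (sym (-0*≈0 0#))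
      where zero-sum = trans (+-identityˡ _) (trans (+-identityˡ _) (zeroʳ _))
    starWeight-⁻⁻ dead   = trans (+-identityˡ _) (trans (+-identityˡ _) (zeroʳ _))

    private
      prependIf-false : ∀ a x → mapBasis (prependIf false a) x ≡ x
      prependIf-false a = LP.map-id

    weighted-star-step : ∀ q sa sb a b {x₁ x₂ x₃} →
      x₁ ≋ scale (αʳ (step q sa) sb) (shuffle (posPart u) (prependIf sb b (posPart v))) →
      x₂ ≋ scale (αˡ (step q sb) sa) (shuffle (prependIf sa a (posPart u)) (posPart v)) →
      x₃ ≋ scale (α (step q sa)) (shuffle (posPart u) (posPart v)) →
      mapBasis (prependIf sa a) x₁ ++ mapBasis (prependIf sb b) x₂
        ++ (if not sa ∧ not sb then scale (- 1#) (mapBasis (prependIf sa a) x₃) else [])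
        ≋ scale (αˡʳ q sa sb) (shuffle (prependIf sa a (posPart u)) (prependIf sb b (posPart v)))
    weighted-star-step q true  true  a b x₁≋ x₂≋ _ =
      both-positive a b (posPart u) (posPart v) (proj₁ (starWeight-⁺⁺ q)) (proj₂ (starWeight-⁺⁺ q)) x₁≋ x₂≋
    weighted-star-step q true  false a b x₁≋ x₂≋ _ =
      positive-negative a (posPart u) (posPart v) (proj₁ (starWeight-⁺⁻ q)) (proj₂ (starWeight-⁺⁻ q))
        x₁≋ (≋-trans (≡⇒≋ (prependIf-false b _)) x₂≋)
    weighted-star-step q false true  a b x₁≋ x₂≋ _ =
      negative-positive b (posPart u) (posPart v) (proj₁ (starWeight-⁻⁺ q)) (proj₂ (starWeight-⁻⁺ q))
        (≋-trans (≡⇒≋ (prependIf-false a _)) x₁≋) x₂≋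
    weighted-star-step q false false a b x₁≋ x₂≋ x₃≋ =
      both-negative (shuffle (posPart u) (posPart v)) (starWeight-⁻⁻ q)
        (≋-trans (≡⇒≋ (prependIf-false a _)) x₁≋) (≋-trans (≡⇒≋ (prependIf-false b _)) x₂≋)
        (≋-trans (≡⇒≋ (prependIf-false a _)) x₃≋)

  private
    isNeg≡not-isPos : ∀ {a} → Nonzero a → isNeg a ≡ not (isPos a)
    isNeg≡not-isPos {+ suc n}   _ = Eq.refl
    isNeg≡not-isPos { -[1+ n ]} _ = Eq.refl

    starWeight-[]ˡ : ∀ q v → 1# * weight q v ≈ starWeight q [] v * 1#
    starWeight-[]ˡ start  v = sym (*-identityʳ _)
    starWeight-[]ˡ neg    v = trans (*-identityˡ _) (trans (weight-neg v)
                                (sym (trans (*-identityʳ _) (+-cong (*-identityˡ _) (-‿cong (*-identityˡ _))))))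
    starWeight-[]ˡ pos    v = sym (*-identityʳ _)
    starWeight-[]ˡ posNeg v = trans (*-identityˡ _) (trans (weight-posNeg v) (sym (trans (*-identityʳ _) (-‿cong (*-identityˡ _)))))
    starWeight-[]ˡ dead   v = trans (*-identityˡ _) (trans (weight-dead v) (sym (zeroˡ _)))

    starWeight-[]ʳ : ∀ q a u → 1# * weight q (a ∷ u) ≈ starWeight q (a ∷ u) [] * 1#
    starWeight-[]ʳ start  a u = trans (*-identityˡ _) (sym (trans (*-identityʳ _) (*-identityʳ _)))
    starWeight-[]ʳ neg    a u = trans (*-identityˡ _) (trans (reflexive (weight-neg-∷ a u))
                                  (sym (trans (*-identityʳ _) (trans (+≈0ʳ _ (-0*≈0 _)) (*-identityʳ _)))))
    starWeight-[]ʳ pos    a u = trans (*-identityˡ _) (sym (trans (*-identityʳ _) (*-identityʳ _)))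
    starWeight-[]ʳ posNeg a u = trans (*-identityˡ _) (trans (trans (weight-posNeg (a ∷ u)) -0#≈0#) (sym (trans (*-identityʳ _) (-0*≈0 _))))
    starWeight-[]ʳ dead   a u = trans (*-identityˡ _) (trans (weight-dead (a ∷ u)) (sym (zeroˡ _)))

  weighted-star : ∀ q u v → AllNonzero u → AllNonzero v →
                  weighted q (star u v) ≋ scale (starWeight q u v) (shuffle (posPart u) (posPart v))
  weighted-star q []      v       _ _ = cons-cong _ (starWeight-[]ˡ q v) ≋-refl
  weighted-star q (a ∷ u) []      _ _ =
    ≋-trans (cons-cong _ (starWeight-[]ʳ q a u) ≋-refl) (≡⇒≋ (Eq.cong (scale _) (Eq.sym (shuffle-[] (posPart (a ∷ u))))))
  weighted-star q (a ∷ u) (b ∷ v) nzu nzv = begin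
    weighted q (prefix a (star u (b ∷ v)) ++ prefix b (star (a ∷ u) v) ++ merged)
      ≡⟨ Eq.trans (weighted-++ q (prefix a (star u (b ∷ v))) _)
                  (Eq.cong₂ _++_ (weighted-prefix q a (star u (b ∷ v))) (weighted-++ q (prefix b (star (a ∷ u) v)) merged)) ⟩
    mapBasis (prependIf sa a) (weighted (step q sa) (star u (b ∷ v))) ++ weighted q (prefix b (star (a ∷ u) v)) ++ weighted q merged
      ≈⟨ ++-cong (≋-refl {mapBasis (prependIf sa a) (weighted (step q sa) (star u (b ∷ v)))})
                 (++-cong (≡⇒≋ (weighted-prefix q b (star (a ∷ u) v))) weighted-merged) ⟩
    mapBasis (prependIf sa a) (weighted (step q sa) (star u (b ∷ v)))
      ++ mapBasis (prependIf sb b) (weighted (step q sb) (star (a ∷ u) v))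
      ++ (if not sa ∧ not sb then scale (- 1#) (mapBasis (prependIf sa a) (weighted (step q sa) (star u v))) else [])
      ≈⟨ weighted-star-step u v q sa sb a b
           (≋-trans (weighted-star (step q sa) u (b ∷ v) (nzu ∘ there) nzv)
                    (≡⇒≋ (Eq.cong (λ P → scale (starWeight (step q sa) u (b ∷ v)) (shuffle (posPart u) P)) (posPart-∷ b v))))
           (≋-trans (weighted-star (step q sb) (a ∷ u) v nzu (nzv ∘ there))
                    (≡⇒≋ (Eq.cong (λ P → scale (starWeight (step q sb) (a ∷ u) v) (shuffle P (posPart v))) (posPart-∷ a u))))
           (weighted-star (step q sa) u v (nzu ∘ there) (nzv ∘ there)) ⟩
    scale (starWeight q (a ∷ u) (b ∷ v)) (shuffle (prependIf sa a (posPart u)) (prependIf sb b (posPart v)))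
      ≡⟨ Eq.cong₂ (λ P P′ → scale (starWeight q (a ∷ u) (b ∷ v)) (shuffle P P′)) (posPart-∷ a u) (posPart-∷ b v) ⟨
    scale (starWeight q (a ∷ u) (b ∷ v)) (shuffle (posPart (a ∷ u)) (posPart (b ∷ v))) ∎
    where
    open ≋-Reasoning
    sa = isPos a
    sb = isPos b
    merged = if isNeg a ∧ isNeg b then scale (- 1#) (prefix a (star u v)) else []
    weighted-merged : weighted q merged ≋
      (if not sa ∧ not sb then scale (- 1#) (mapBasis (prependIf sa a) (weighted (step q sa) (star u v))) else [])
    weighted-merged rewrite isNeg≡not-isPos (nzu (here Eq.refl)) | isNeg≡not-isPos (nzv (here Eq.refl)) with not sa ∧ not sb
    ... | true  = ≋-trans (weighted-scale q (- 1#) _) (scale-cong refl (≡⇒≋ (weighted-prefix q a (star u v))))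
    ... | false = ≋-refl

  starProduct : Word → Word → FS Word
  starProduct σ τ = mapBasis st (star σ (shift (length σ) τ))

  shuffleProduct : Word → Word → FS Word
  shuffleProduct σ τ = shuffle σ (shift (length σ) τ)

  φ₂-starProduct : ∀ {σ τ} → IsSignedPerm σ → IsSignedPerm τ →
                   linExt φ₂-basis (starProduct σ τ) ≋ bilinExt shuffleProduct (φ₂-basis σ) (φ₂-basis τ)
  φ₂-starProduct {σ} {τ} π ρ = begin
    linExt φ₂-basis (mapBasis st Z)
      ≡⟨ linExt-mapBasis φ₂-basis st Z ⟩
    linExt (φ₂-basis ∘ st) Z
      ≈⟨ linExt-cong Z (All.map (λ (t⊆ , dt) → φ₂-basis-st dt (nzστ′ ∘ t⊆)) (star-within σ τ′ dστ′)) ⟩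
    linExt (λ w → (weight start w , st (posPart w)) ∷ []) Z
      ≡⟨ Eq.trans (linExt-singletons (weight start) (st ∘ posPart) Z) (LP.map-∘ Z) ⟩
    mapBasis st (weighted start Z)
      ≈⟨ mapBasis-resp wordEq? st (weighted-star start σ τ′ nzσ nzτ′) ⟩
    mapBasis st (scale (weight start σ * weight start τ′) (shuffle (posPart σ) (posPart τ′)))
      ≡⟨ scale-mapBasis _ st (shuffle (posPart σ) (posPart τ′)) ⟨
    scale (weight start σ * weight start τ′) (mapBasis st (shuffle (posPart σ) (posPart τ′)))
      ≡⟨ Eq.cong₂ (λ k P → scale (weight start σ * k) (mapBasis st (shuffle (posPart σ) P))) weight-τ′ posPart-τ′ ⟩
    scale (weight start σ * weight start τ) (mapBasis st (shuffle (posPart σ) (shift (length σ) (posPart τ))))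
      ≡⟨ Eq.cong (scale _) (st-shuffle (length σ) (signedPerm-bounded π ∘ ∈-posPart) (nzτ ∘ ∈-posPart)
                              (AllPairsP.filter⁺ _ dσ) (AllPairsP.filter⁺ _ (signedPerm-distinct ρ))) ⟩
    scale (weight start σ * weight start τ) (shuffleProduct (st (posPart σ)) (st (posPart τ)))
      ≈⟨ ≋-trans (bilinExt-resp wordEq? wordEq? shuffleProduct (φ₂-basis-formula σ nzσ) (φ₂-basis-formula τ nzτ))
                 (≋-trans (++-[] _) (++-[] _)) ⟨
    bilinExt shuffleProduct (φ₂-basis σ) (φ₂-basis τ) ∎
    where
    open ≋-Reasoning
    τ′ = shift (length σ) τ
    Z = star σ τ′
    dσ = signedPerm-distinct π
    nzσ = signedPerm-nonzero π
    nzτ = signedPerm-nonzero ρ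
    nzτ′ = shift-allNonzero (length σ) nzτ
    dστ′ = distinctAbs-++-shift (length σ) (signedPerm-bounded π) nzτ dσ (signedPerm-distinct ρ)
    nzστ′ : AllNonzero (σ ++ τ′)
    nzστ′ x∈ with ∈-++⁻ σ x∈
    ... | inj₁ x∈σ  = nzσ x∈σ
    ... | inj₂ x∈τ′ = nzτ′ x∈τ′
    weight-τ′ : weight start τ′ ≡ weight start τ
    weight-τ′ = Eq.cong value (run-signs start (Eq.trans (Eq.sym (LP.map-∘ τ)) (LP.map-cong (shift-isPos (length σ)) τ)))
    posPart-τ′ : posPart τ′ ≡ shift (length σ) (posPart τ)
    posPart-τ′ = posPart-map (shiftL (length σ)) τ (λ {a} _ → shift-isPos (length σ) a)

  φ₂-multiplicative : ∀ x y → IsHSym x → IsHSym y → φ₂ (x ⋆H y) ≋ φ₂ x ⧢S φ₂ y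
  φ₂-multiplicative x y perms₁ perms₂ = begin
    linExt φ₂-basis (bilinExt starProduct x y)
      ≈⟨ linExt-bilinExt φ₂-basis starProduct x y ⟩
    bilinExt (λ σ τ → linExt φ₂-basis (starProduct σ τ)) x y
      ≈⟨ bilinExt-cong x y (All.map (λ π → All.map (φ₂-starProduct π) perms₂) perms₁) ⟩
    bilinExt (λ σ τ → bilinExt shuffleProduct (φ₂-basis σ) (φ₂-basis τ)) x y
      ≈⟨ bilinExt-linExt shuffleProduct φ₂-basis φ₂-basis x y ⟨
    bilinExt shuffleProduct (linExt φ₂-basis x) (linExt φ₂-basis y) ∎
    where open ≋-Reasoning

theorem4p10 : ∀ {c ℓ} (K : CommutativeRing c ℓ) → let open WithRing K in
    ((x y : FS Word) → IsHSym x → IsHSym y → φ₂ (x ⋆H y) ≈F (φ₂ x ⧢S φ₂ y))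
    × (φ₂ unit ≈F unit)
    × ((x : FS Word) → IsHSym x → Δ (φ₂ x) ≈T φ₂⊗φ₂ (Δ x))
    × ((x : FS Word) → IsHSym x → ε (φ₂ x) ≈K ε x)
theorem4p10 K =
    (λ x y hx hy → Words.≋-coefficient (φ₂-multiplicative x y hx hy))
  , Words.≋-coefficient φ₂-unit
  , (λ x hx → Pairs.≋-coefficient (φ₂-comultiplicative x hx))
  , φ₂-counit
  where
  module Words = FormalSums.Linear K wordEq?
  module Pairs = FormalSums.Linear K (×P.≡-dec wordEq? wordEq?)
  open Phi₂Basis K using (φ₂-unit; φ₂-counit)
  open Product K using (φ₂-multiplicative)
  open Coproduct K using (φ₂-comultiplicative)
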